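{- Let $f\colon \mathbb{N}\to\mathbb{R}^{\geq 0}$ be the function defined in the context. Let $a,b\in\mathbb{N}$ with $a\neq b$ and $f(b)>f(a)$. Then $f(b)-f(a)\geq \frac{1}{|b-a|}$.
   Context: $\mathbb{N}=\{0,1,2,\dots\}$. Let $F_n$ denote the Fibonacci numbers, $F_0=0$, $F_1=1$, $F_n=F_{n-1}+F_{n-2}$ for $n>1$, and let $u_i=F_{2i}$ for $i\geq 1$. Every $N\in\mathbb{N}$ has a unique representation $N=\sum_{i=1}^\infty d_iu_i$ with digits $d_i\in\{0,1,2\}$, only finitely many nonzero, such that whenever $i<j$ and $d_i=d_j=2$ there exists $l$ with $i<l<j$ and $d_l=0$. For $a\in\mathbb{N}$ write $d^a_i$ for the digits of this representation of $a$, and define $f(a)=\sum_{i=1}^\infty \frac{d^a_i}{u_i}$. -}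

module Defs where

open import Data.Nat as ℕ using (ℕ; zero; suc; _+_; _*_; _<_; _≤_; NonZero; ∣_-_∣; z≤n; s≤s)
import Data.Nat.Properties
open Data.Nat.Properties using (≤-trans; m≤m+n)
open import Data.Integer using (+_)
open import Data.Rational as ℚ using (ℚ; 0ℚ; _/_)
open import Data.List using (List; []; _∷_; lookup; length)
open import Data.List.Relation.Unary.All using (All)
open import Data.Product using (Σ; _×_)
open import Relation.Binary.PropositionalEquality using (_≡_; _≢_)
open import Relation.Nullary using (¬_)

fib : ℕ → ℕ
fib zero = 0
fib (suc zero) = 1
fib (suc (suc n)) = fib (suc n) + fib n

-- u_i = F_{2i}  (used for i ≥ 1)
u : ℕ → ℕ
u i = fib (2 * i)

fib-suc-pos : ∀ n → 1 ≤ fib (suc n)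
fib-suc-pos zero = s≤s z≤n
fib-suc-pos (suc n) = ≤-trans (fib-suc-pos n) (m≤m+n (fib (suc n)) (fib n))

u-suc-nonZero : ∀ k → NonZero (u (suc k))
u-suc-nonZero k rewrite Data.Nat.Properties.+-suc k (k + 0) = ℕ.>-nonZero (fib-suc-pos (suc (k + (k + 0))))

-- A digit string is a list ds = [d_1, d_2, ..., d_m]; list position k
-- (0-based) holds the digit d_{k+1}.  Digits beyond the list are 0.
digit : List ℕ → ℕ → ℕ
digit [] _ = 0
digit (d ∷ ds) zero = d
digit (d ∷ ds) (suc k) = digit ds k

valueFrom : ℕ → List ℕ → ℕ
valueFrom k [] = 0
valueFrom k (d ∷ ds) = d * u (suc k) + valueFrom (suc k) ds

value : List ℕ → ℕ
value ds = valueFrom 0 ds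

recipFrom : ℕ → List ℕ → ℚ
recipFrom k [] = 0ℚ
recipFrom k (d ∷ ds) = ((+ d) / u (suc k)) {{u-suc-nonZero k}} ℚ.+ recipFrom (suc k) ds

IsRep : List ℕ → ℕ → Set
IsRep ds N =
  All (_≤ 2) ds
  × value ds ≡ N
  × (∀ i j → i < j → digit ds i ≡ 2 → digit ds j ≡ 2 →
       Σ ℕ (λ l → i < l × l < j × digit ds l ≡ 0))

-- f evaluated on a digit string: f(a) = Σ_i d^a_i / u_i  where ds is the
-- representation of a.
fRep : List ℕ → ℚ
fRep ds = recipFrom 0 ds

dist-nonZero : ∀ {a b} → a ≢ b → NonZero ∣ a - b ∣
dist-nonZero {a} {b} a≢b = ℕ.≢-nonZero (λ eq → a≢b (Data.Nat.Properties.∣m-n∣≡0⇒m≡n eq))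

module Submission where

-- Write e j = d^b_{j+1} - d^a_{j+1}, so that b - a = V = Σ_j e j u_{j+1} and f(b) - f(a) = D = Σ_j e j / u_{j+1}.
-- Expanding V·D pairwise with u_x/u_y + u_y/u_x = L + u_{x-y}²/(u_x u_y), L an integer, gives V·D = N + C,
-- where N = Q(V, P) is an integer (Q(x, y) = x² - 3xy + y², P = Σ_j e j u_j) and, telescoping
-- u_d/(u_i u_{i+d}) over the weights w t = 1/(u_{t+1} u_{t+2}), C = Σ_t G_t w t with
-- G_t = Σ_{i ≤ t < j} e i e j u_{j-i}. By the addition formula G_t combines digit sums above and below t.
-- For greedy digit strings a sum Σ_j e j ω j with suitable increasing weights has the sign of the most
-- significant difference, one with decreasing weights that of the least significant difference, and
-- D > 0 forces the latter to favour b. Hence either V ≥ 1, every G_t ≥ 0 and N ≥ 1, or V ≤ -1,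
-- every G_t ≤ 0 and N ≤ -1; in both cases |V|·D ≥ 1. The bounds on N come from
-- N u_{n+1}² = V² + (3u_{n+1} - 2u_n) A V + A², where 1 ≤ A = Σ_j e j u_{n-j} ≤ u_{n+1} - 1.

open import Algebra.Bundles using (CommutativeRing)
open import Data.Integer.Base using (ℤ)
open import Data.Nat.Base using (ℕ)

module RangeSum {c ℓ} (R : CommutativeRing c ℓ) where
  open import Data.Nat as ℕ using (ℕ; zero; suc; _<_; _∸_)
  import Data.Nat.Properties as ℕ
  open import Relation.Binary.PropositionalEquality as ≡ using (_≡_)

  open CommutativeRing R
  open import Algebra.Properties.Ring ring using (-‿+-comm; -0#≈0#)
  open import Algebra.Properties.CommutativeSemigroup +-commutativeSemigroup using (interchange)
  open import Relation.Binary.Reasoning.Setoid setoid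

  ∑ : ℕ → (ℕ → Carrier) → Carrier
  ∑ zero    f = 0#
  ∑ (suc n) f = ∑ n f + f n

  syntax ∑ n (λ i → x) = ∑[ i < n ] x

  ∑-cong : ∀ n {f g : ℕ → Carrier} → (∀ i → i < n → f i ≈ g i) → ∑ n f ≈ ∑ n g
  ∑-cong zero    f≈g = refl
  ∑-cong (suc n) f≈g = +-cong (∑-cong n λ i i<n → f≈g i (ℕ.m<n⇒m<1+n i<n)) (f≈g n ℕ.≤-refl)

  ∑-zero : ∀ n {f : ℕ → Carrier} → (∀ i → i < n → f i ≈ 0#) → ∑ n f ≈ 0#
  ∑-zero n {f} f≈0 = trans (∑-cong n f≈0) (zero-sum n)
    where
    zero-sum : ∀ n → ∑[ i < n ] 0# ≈ 0#
    zero-sum zero    = refl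
    zero-sum (suc n) = trans (+-identityʳ _) (zero-sum n)

  ∑-distrib-+ : ∀ n (f g : ℕ → Carrier) → ∑[ i < n ] (f i + g i) ≈ ∑ n f + ∑ n g
  ∑-distrib-+ zero    f g = sym (+-identityˡ 0#)
  ∑-distrib-+ (suc n) f g = trans (+-congʳ (∑-distrib-+ n f g)) (interchange _ _ _ _)

  ∑-distrib-neg : ∀ n (f : ℕ → Carrier) → ∑[ i < n ] (- f i) ≈ - ∑ n f
  ∑-distrib-neg zero    f = sym -0#≈0#
  ∑-distrib-neg (suc n) f = trans (+-congʳ (∑-distrib-neg n f)) (-‿+-comm _ _)

  ∑-distrib-sub : ∀ n (f g : ℕ → Carrier) → ∑[ i < n ] (f i - g i) ≈ ∑ n f - ∑ n g
  ∑-distrib-sub n f g = trans (∑-distrib-+ n f (λ i → - g i)) (+-congˡ (∑-distrib-neg n g))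

  *-distribˡ-∑ : ∀ n x (f : ℕ → Carrier) → x * ∑ n f ≈ ∑[ i < n ] (x * f i)
  *-distribˡ-∑ zero    x f = zeroʳ x
  *-distribˡ-∑ (suc n) x f = trans (distribˡ x _ _) (+-congʳ (*-distribˡ-∑ n x f))

  *-distribʳ-∑ : ∀ n x (f : ℕ → Carrier) → ∑ n f * x ≈ ∑[ i < n ] (f i * x)
  *-distribʳ-∑ n x f = begin
    ∑ n f * x            ≈⟨ *-comm _ x ⟩
    x * ∑ n f            ≈⟨ *-distribˡ-∑ n x f ⟩
    ∑[ i < n ] (x * f i) ≈⟨ ∑-cong n (λ i _ → *-comm x (f i)) ⟩
    ∑[ i < n ] (f i * x) ∎

  ∑-front : ∀ n (f : ℕ → Carrier) → ∑ (suc n) f ≈ f 0 + ∑[ i < n ] f (suc i)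
  ∑-front zero    f = trans (+-identityˡ _) (sym (+-identityʳ _))
  ∑-front (suc n) f = trans (+-congʳ (∑-front n f)) (+-assoc _ _ _)

  ∑-split : ∀ m k (f : ℕ → Carrier) → ∑ (m ℕ.+ k) f ≈ ∑ m f + ∑[ i < k ] f (m ℕ.+ i)
  ∑-split m zero    f = ≡.subst (λ z → ∑ z f ≈ ∑ m f + 0#) (≡.sym (ℕ.+-identityʳ m)) (sym (+-identityʳ _))
  ∑-split m (suc k) f = begin
    ∑ (m ℕ.+ suc k) f                               ≡⟨ ≡.cong (λ z → ∑ z f) (ℕ.+-suc m k) ⟩
    ∑ (m ℕ.+ k) f + f (m ℕ.+ k)                     ≈⟨ +-congʳ (∑-split m k f) ⟩
    ∑ m f + ∑[ i < k ] f (m ℕ.+ i) + f (m ℕ.+ k)    ≈⟨ +-assoc _ _ _ ⟩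
    ∑ m f + ∑[ i < suc k ] f (m ℕ.+ i) ∎

  ∑-zero-tail : ∀ m k (f : ℕ → Carrier) → (∀ i → i < k → f (m ℕ.+ i) ≈ 0#) → ∑ (m ℕ.+ k) f ≈ ∑ m f
  ∑-zero-tail m k f tail≈0 = begin
    ∑ (m ℕ.+ k) f                   ≈⟨ ∑-split m k f ⟩
    ∑ m f + ∑[ i < k ] f (m ℕ.+ i)  ≈⟨ +-congˡ (∑-zero k tail≈0) ⟩
    ∑ m f + 0#                      ≈⟨ +-identityʳ _ ⟩
    ∑ m f ∎

  ∑-triangle : ∀ n (f g : ℕ → Carrier) →
    ∑[ t < n ] (∑ (suc t) f * g t) ≈ ∑[ j < n ] (f j * ∑[ t < n ∸ j ] g (j ℕ.+ t))
  ∑-triangle zero    f g = refl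
  ∑-triangle (suc n) f g = begin
    ∑[ t < n ] (∑ (suc t) f * g t) + ∑ (suc n) f * g n
      ≈⟨ +-cong (∑-triangle n f g) (*-distribʳ-∑ (suc n) (g n) f) ⟩
    ∑[ j < n ] (f j * T n j) + (∑[ j < n ] (f j * g n) + f n * g n)
      ≈⟨ +-assoc _ _ _ ⟨
    ∑[ j < n ] (f j * T n j) + ∑[ j < n ] (f j * g n) + f n * g n
      ≈⟨ +-congʳ (∑-distrib-+ n _ _) ⟨
    ∑[ j < n ] (f j * T n j + f j * g n) + f n * g n
      ≈⟨ +-cong (∑-cong n λ j j<n → trans (sym (distribˡ (f j) _ _)) (*-congˡ (sym (T-suc j<n)))) (*-congˡ T-last) ⟩
    ∑[ j < suc n ] (f j * T (suc n) j) ∎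
    where
    T : ℕ → ℕ → Carrier
    T n j = ∑[ t < n ∸ j ] g (j ℕ.+ t)
    T-suc : ∀ {j} → j < n → T (suc n) j ≈ T n j + g n
    T-suc {j} j<n rewrite ℕ.+-∸-assoc 1 (ℕ.<⇒≤ j<n) | ℕ.m+[n∸m]≡n (ℕ.<⇒≤ j<n) = refl
    T-last : g n ≈ T (suc n) n
    T-last rewrite ℕ.m+n∸n≡m 1 n | ℕ.+-identityʳ n = sym (+-identityˡ (g n))

module EvenFibonacci where
  open import Data.Nat as ℕ using (ℕ; zero; suc)
  import Data.Nat.Properties as ℕ
  open import Data.Integer using (ℤ; +_; 0ℤ; 1ℤ; _+_; _*_; _-_; _≤_; +≤+)
  open import Data.Integer.Properties
  open import Data.Integer.Tactic.RingSolver using (solve-∀)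
  open import Relation.Binary.PropositionalEquality
  open ≡-Reasoning

  open import Defs using (fib; u; fib-suc-pos)

  U : ℕ → ℤ
  U k = + u k

  Δ : ℕ → ℤ
  Δ k = + fib (suc (2 ℕ.* k))

  U-suc : ∀ k → U (suc k) ≡ U k + Δ k
  U-suc k = begin
    + fib (2 ℕ.* suc k)                        ≡⟨ cong (λ m → + fib m) (ℕ.*-suc 2 k) ⟩
    + (fib (suc (2 ℕ.* k)) ℕ.+ fib (2 ℕ.* k))  ≡⟨ pos-+ (fib (suc (2 ℕ.* k))) _ ⟩
    Δ k + U k                                  ≡⟨ +-comm (Δ k) (U k) ⟩
    U k + Δ k ∎

  Δ-suc : ∀ k → Δ (suc k) ≡ Δ k + U (suc k)
  Δ-suc k = begin
    + fib (suc (2 ℕ.* suc k))                          ≡⟨ cong (λ m → + fib (suc m)) (ℕ.*-suc 2 k) ⟩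
    + (fib (2 ℕ.+ 2 ℕ.* k) ℕ.+ fib (suc (2 ℕ.* k)))    ≡⟨ pos-+ (fib (2 ℕ.+ 2 ℕ.* k)) _ ⟩
    + fib (2 ℕ.+ 2 ℕ.* k) + Δ k                        ≡⟨ cong (λ m → + fib m + Δ k) (ℕ.*-suc 2 k) ⟨
    U (suc k) + Δ k                                    ≡⟨ +-comm (U (suc k)) (Δ k) ⟩
    Δ k + U (suc k) ∎

  U-rec : ∀ k → U (suc (suc k)) ≡ + 3 * U (suc k) - U k
  U-rec k = begin
    U (suc (suc k))                   ≡⟨ U-suc (suc k) ⟩
    U (suc k) + Δ (suc k)             ≡⟨ cong (λ x → U (suc k) + x) (Δ-suc k) ⟩
    U (suc k) + (Δ k + U (suc k))     ≡⟨ cong (λ x → x + (Δ k + x)) (U-suc k) ⟩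
    U k + Δ k + (Δ k + (U k + Δ k))   ≡⟨ algebra (U k) (Δ k) ⟩
    + 3 * (U k + Δ k) - U k           ≡⟨ cong (λ x → + 3 * x - U k) (U-suc k) ⟨
    + 3 * U (suc k) - U k ∎
    where
    algebra : ∀ a d → a + d + (d + (a + d)) ≡ + 3 * (a + d) - a
    algebra = solve-∀

  Q : ℤ → ℤ → ℤ
  Q x y = x * x - + 3 * x * y + y * y

  -- The polar form of Q: Q (x + x′) (y + y′) = Q x y + Q x′ y′ + B x y x′ y′.
  B : ℤ → ℤ → ℤ → ℤ → ℤ
  B x y x′ y′ = + 2 * x * x′ - + 3 * (x * y′ + x′ * y) + + 2 * y * y′

  cassini : ∀ k → Q (U (suc k)) (U k) ≡ 1ℤ
  cassini zero    = refl
  cassini (suc k) = begin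
    Q (U (suc (suc k))) (U (suc k))           ≡⟨ cong (λ x → Q x (U (suc k))) (U-rec k) ⟩
    Q (+ 3 * U (suc k) - U k) (U (suc k))     ≡⟨ algebra (U (suc k)) (U k) ⟩
    Q (U (suc k)) (U k)                       ≡⟨ cassini k ⟩
    1ℤ ∎
    where
    algebra : ∀ x y → (+ 3 * x - y) * (+ 3 * x - y) - + 3 * (+ 3 * x - y) * x + x * x
                    ≡ x * x - + 3 * x * y + y * y
    algebra = solve-∀

  casoratian : ∀ i d → U (suc i) * U (i ℕ.+ d) - U i * U (suc (i ℕ.+ d)) ≡ U d
  casoratian zero    d = algebra (U d)
    where
    algebra : ∀ x → 1ℤ * x - 0ℤ * + 1 ≡ x
    algebra = solve-∀
  casoratian (suc i) d = begin
    U (suc (suc i)) * U (suc (i ℕ.+ d)) - U (suc i) * U (suc (suc (i ℕ.+ d)))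
      ≡⟨ cong₂ (λ x y → x * U (suc (i ℕ.+ d)) - U (suc i) * y) (U-rec i) (U-rec (i ℕ.+ d)) ⟩
    (+ 3 * U (suc i) - U i) * U (suc (i ℕ.+ d)) - U (suc i) * (+ 3 * U (suc (i ℕ.+ d)) - U (i ℕ.+ d))
      ≡⟨ algebra (U (suc i)) (U i) (U (suc (i ℕ.+ d))) (U (i ℕ.+ d)) ⟩
    U (suc i) * U (i ℕ.+ d) - U i * U (suc (i ℕ.+ d))
      ≡⟨ casoratian i d ⟩
    U d ∎
    where
    algebra : ∀ a a′ b b′ → (+ 3 * a - a′) * b - a * (+ 3 * b - b′) ≡ a * b′ - a′ * b
    algebra = solve-∀

  U-addition : ∀ x y → U (suc (x ℕ.+ y)) ≡ U (suc x) * U (suc y) - U x * U y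
  U-addition zero    y = algebra (U (suc y)) (U y)
    where
    algebra : ∀ a b → a ≡ 1ℤ * a - 0ℤ * b
    algebra = solve-∀
  U-addition (suc x) y = begin
    U (suc (suc x ℕ.+ y))                                   ≡⟨ cong (λ m → U (suc m)) (ℕ.+-suc x y) ⟨
    U (suc (x ℕ.+ suc y))                                   ≡⟨ U-addition x (suc y) ⟩
    U (suc x) * U (suc (suc y)) - U x * U (suc y)           ≡⟨ cong (λ z → U (suc x) * z - U x * U (suc y)) (U-rec y) ⟩
    U (suc x) * (+ 3 * U (suc y) - U y) - U x * U (suc y)   ≡⟨ algebra (U (suc x)) (U x) (U (suc y)) (U y) ⟩
    (+ 3 * U (suc x) - U x) * U (suc y) - U (suc x) * U y   ≡⟨ cong (λ z → z * U (suc y) - U (suc x) * U y) (U-rec x) ⟨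
    U (suc (suc x)) * U (suc y) - U (suc x) * U y ∎
    where
    algebra : ∀ a a′ b b′ → a * (+ 3 * b - b′) - a′ * b ≡ (+ 3 * a - a′) * b - a * b′
    algebra = solve-∀

  U-sum-of-squares : ∀ j d →
    U (suc (j ℕ.+ d)) * U (suc (j ℕ.+ d)) + U (suc j) * U (suc j)
      ≡ B (U (suc (j ℕ.+ d))) (U (j ℕ.+ d)) (U (suc j)) (U j) * U (suc j) * U (suc (j ℕ.+ d)) + U d * U d
  U-sum-of-squares j d = begin
    x * x + x′ * x′
      ≡⟨ algebra x y x′ y′ ⟩
    B x y x′ y′ * x′ * x + (x′ * y - y′ * x) * (x′ * y - y′ * x) + x * x * (1ℤ - Q x′ y′) + x′ * x′ * (1ℤ - Q x y)
      ≡⟨ cong₂ (λ s t → B x y x′ y′ * x′ * x + s * s + x * x * (1ℤ - t) + x′ * x′ * (1ℤ - Q x y))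
               (casoratian j d) (cassini j) ⟩
    B x y x′ y′ * x′ * x + U d * U d + x * x * 0ℤ + x′ * x′ * (1ℤ - Q x y)
      ≡⟨ cong (λ t → B x y x′ y′ * x′ * x + U d * U d + x * x * 0ℤ + x′ * x′ * (1ℤ - t)) (cassini (j ℕ.+ d)) ⟩
    B x y x′ y′ * x′ * x + U d * U d + x * x * 0ℤ + x′ * x′ * 0ℤ
      ≡⟨ drop-zeros (B x y x′ y′ * x′ * x + U d * U d) (x * x) (x′ * x′) ⟩
    B x y x′ y′ * x′ * x + U d * U d ∎
    where
    x y x′ y′ : ℤ
    x = U (suc (j ℕ.+ d))
    y = U (j ℕ.+ d)
    x′ = U (suc j)
    y′ = U j
    algebra : ∀ x y x′ y′ → x * x + x′ * x′
      ≡ (+ 2 * x * x′ - + 3 * (x * y′ + x′ * y) + + 2 * y * y′) * x′ * x + (x′ * y - y′ * x) * (x′ * y - y′ * x)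
        + x * x * (1ℤ - (x′ * x′ - + 3 * x′ * y′ + y′ * y′)) + x′ * x′ * (1ℤ - (x * x - + 3 * x * y + y * y))
    algebra = solve-∀
    drop-zeros : ∀ a b c → a + b * 0ℤ + c * 0ℤ ≡ a
    drop-zeros = solve-∀

  U-nonneg : ∀ k → 0ℤ ≤ U k
  U-nonneg k = +≤+ ℕ.z≤n

  Δ-nonneg : ∀ k → 0ℤ ≤ Δ k
  Δ-nonneg k = +≤+ ℕ.z≤n

  Δ-pos : ∀ k → 1ℤ ≤ Δ k
  Δ-pos k = +≤+ (fib-suc-pos (2 ℕ.* k))

  U≤Δ : ∀ k → U k ≤ Δ k
  U≤Δ zero    = +≤+ ℕ.z≤n
  U≤Δ (suc k) = subst (U (suc k) ≤_) (sym (Δ-suc k)) (i≤j+i (U (suc k)) (Δ k))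

  Δ≤U-suc : ∀ k → Δ k ≤ U (suc k)
  Δ≤U-suc k = subst (Δ k ≤_) (sym (U-suc k)) (i≤j+i (Δ k) (U k))

  U-suc-pos : ∀ k → 1ℤ ≤ U (suc k)
  U-suc-pos k = ≤-trans (Δ-pos k) (Δ≤U-suc k)

  U-mono : ∀ k → U k ≤ U (suc k)
  U-mono k = subst (U k ≤_) (sym (U-suc k)) (i≤i+j (U k) (Δ k))

  Δ-mono : ∀ k → Δ k ≤ Δ (suc k)
  Δ-mono k = subst (Δ k ≤_) (sym (Δ-suc k)) (i≤i+j (Δ k) (U (suc k)))

  U-double : ∀ k → U k + U k ≤ U (suc k)
  U-double k = subst (U k + U k ≤_) (sym (U-suc k)) (+-monoʳ-≤ (U k) (U≤Δ k))

  Δ-double : ∀ k → Δ k + Δ k ≤ Δ (suc k)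
  Δ-double k = subst (Δ k + Δ k ≤_) (sym (Δ-suc k)) (+-monoʳ-≤ (Δ k) (Δ≤U-suc k))

  U-consecutive-products : ∀ k → U (suc k) * U (suc (suc k)) + U k * U (suc k) ≡ + 3 * (U k * U (suc (suc k))) + + 3
  U-consecutive-products k = begin
    b * U (suc (suc k)) + a * b
      ≡⟨ cong (λ c → b * c + a * b) (U-rec k) ⟩
    b * (+ 3 * b - a) + a * b
      ≡⟨ algebra a b ⟩
    + 3 * (a * (+ 3 * b - a)) + + 3 * Q b a
      ≡⟨ cong₂ (λ c q → + 3 * (a * c) + + 3 * q) (sym (U-rec k)) (cassini k) ⟩
    + 3 * (a * U (suc (suc k))) + + 3 ∎
    where
    a b : ℤ
    a = U k
    b = U (suc k)
    algebra : ∀ a b → b * (+ 3 * b - a) + a * b ≡ + 3 * (a * (+ 3 * b - a)) + + 3 * (b * b - + 3 * b * a + a * a)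
    algebra = solve-∀

module IntegerOrder where
  open import Data.Integer using (ℤ; +_; 0ℤ; _+_; _*_; _≤_; +≤+; nonNegative)
  open import Data.Integer.Properties
  open import Data.Nat as ℕ using (ℕ; zero; suc; _<_)
  import Data.Nat.Properties as ℕ
  open import Relation.Binary.PropositionalEquality

  open RangeSum +-*-commutativeRing

  nonneg-+ : ∀ {x y} → 0ℤ ≤ x → 0ℤ ≤ y → 0ℤ ≤ x + y
  nonneg-+ = +-mono-≤

  nonneg-* : ∀ {x y} → 0ℤ ≤ x → 0ℤ ≤ y → 0ℤ ≤ x * y
  nonneg-* {x} {y} 0≤x 0≤y = subst (_≤ x * y) (*-zeroˡ y) (*-monoʳ-≤-nonNeg y {{nonNegative 0≤y}} {0ℤ} {x} 0≤x)

  digit-nonneg : ∀ d {w} → 0ℤ ≤ w → 0ℤ ≤ + d * w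
  digit-nonneg d = nonneg-* {+ d} (+≤+ ℕ.z≤n)

  ≤-of-gap : ∀ {x y} d → 0ℤ ≤ d → y ≡ x + d → x ≤ y
  ≤-of-gap {x} d 0≤d refl = subst (_≤ x + d) (+-identityʳ x) (+-monoʳ-≤ x 0≤d)

  ∑-nonneg : ∀ n {f : ℕ → ℤ} → (∀ i → i < n → 0ℤ ≤ f i) → 0ℤ ≤ ∑ n f
  ∑-nonneg zero    0≤f = ≤-refl
  ∑-nonneg (suc n) 0≤f = nonneg-+ (∑-nonneg n λ i i<n → 0≤f i (ℕ.m<n⇒m<1+n i<n)) (0≤f n ℕ.≤-refl)

  nonpos-* : ∀ {x y} → x ≤ 0ℤ → 0ℤ ≤ y → x * y ≤ 0ℤ
  nonpos-* {x} {y} x≤0 0≤y = subst (x * y ≤_) (*-zeroˡ y) (*-monoʳ-≤-nonNeg y {{nonNegative 0≤y}} {x} {0ℤ} x≤0)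

module DigitStrings where
  open import Data.Bool using (Bool; true; false; if_then_else_)
  open import Data.Empty using (⊥-elim)
  open import Data.Nat using (ℕ; zero; suc; _+_; _∸_; _<_; _≤_; z≤n; s≤s)
  open import Data.Nat.Properties
  open import Data.Product using (Σ; _×_; _,_)
  open import Data.Sum using (inj₁; inj₂)
  open import Relation.Binary.PropositionalEquality

  Separated : (ℕ → ℕ) → Set
  Separated c = ∀ i j → i < j → c i ≡ 2 → c j ≡ 2 → Σ ℕ λ l → i < l × l < j × c l ≡ 0

  Valid : (ℕ → ℕ) → Set
  Valid c = (∀ i → c i ≤ 2) × Separated c

  Valid-shift : ∀ {c} k → Valid c → Valid (λ i → c (k + i))
  Valid-shift {c} k (c≤2 , sep) = (λ i → c≤2 (k + i)) , sep′
    where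
    sep′ : Separated (λ i → c (k + i))
    sep′ i j i<j ci≡2 cj≡2 with sep (k + i) (k + j) (+-monoʳ-< k i<j) ci≡2 cj≡2
    ... | l , k+i<l , l<k+j , cl≡0 = l ∸ k , i<l∸k , l∸k<j , subst (λ m → c m ≡ 0) (sym k+[l∸k]≡l) cl≡0
      where
      k+[l∸k]≡l : k + (l ∸ k) ≡ l
      k+[l∸k]≡l = m+[n∸m]≡n (≤-trans (m≤m+n k i) (<⇒≤ k+i<l))
      i<l∸k : i < l ∸ k
      i<l∸k = +-cancelˡ-< k i (l ∸ k) (subst (k + i <_) (sym k+[l∸k]≡l) k+i<l)
      l∸k<j : l ∸ k < j
      l∸k<j = +-cancelˡ-< k (l ∸ k) j (subst (_< k + j) (sym k+[l∸k]≡l) l<k+j)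

  -- blocked c p: a digit 2 occurs below p with no 0 after it, so c p ≠ 2.
  blocked-step : ℕ → Bool → Bool
  blocked-step zero          _ = false
  blocked-step (suc zero)    b = b
  blocked-step (suc (suc _)) _ = true

  blocked : (ℕ → ℕ) → ℕ → Bool
  blocked c zero    = false
  blocked c (suc p) = blocked-step (c p) (blocked c p)

  blocked-witness : ∀ c p → blocked c p ≡ true →
    Σ ℕ λ i → i < p × 2 ≤ c i × (∀ l → i < l → l < p → c l ≢ 0)
  blocked-witness c (suc p) eq with c p in cp
  ... | suc zero with blocked-witness c p eq
  ...   | i , i<p , 2≤ci , no-zero = i , m<n⇒m<1+n i<p , 2≤ci , no-zero′
    where
    no-zero′ : ∀ l → i < l → l < suc p → c l ≢ 0
    no-zero′ l i<l l<1+p with m≤n⇒m<n∨m≡n (≤-pred l<1+p)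
    ... | inj₁ l<p  = no-zero l i<l l<p
    ... | inj₂ refl = λ cp≡0 → 1≢0 (trans (sym cp) cp≡0)
      where
      1≢0 : 1 ≢ 0
      1≢0 ()
  blocked-witness c (suc p) eq | suc (suc _) =
    p , ≤-refl , subst (2 ≤_) (sym cp) (s≤s (s≤s z≤n)) ,
    λ l p<l l<1+p → ⊥-elim (<-irrefl refl (<-≤-trans p<l (≤-pred l<1+p)))

  blocked⇒≢2 : ∀ {c} → Valid c → ∀ p → blocked c p ≡ true → c p ≢ 2
  blocked⇒≢2 {c} (c≤2 , sep) p eq cp≡2 with blocked-witness c p eq
  ... | i , i<p , 2≤ci , no-zero with sep i p i<p (≤-antisym (c≤2 i) 2≤ci) cp≡2
  ...   | l , i<l , l<p , cl≡0 = no-zero l i<l l<p cl≡0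

  data DigitCase (c : ℕ → ℕ) (p : ℕ) : Set where
    digit0 : c p ≡ 0 → DigitCase c p
    digit1 : c p ≡ 1 → DigitCase c p
    digit2 : c p ≡ 2 → blocked c p ≡ false → DigitCase c p

  digitCase : ∀ {c} → Valid c → ∀ p → DigitCase c p
  digitCase {c} valid@(c≤2 , _) p with c p in cp | c≤2 p
  ... | zero                 | _ = digit0 cp
  ... | suc zero             | _ = digit1 cp
  ... | suc (suc zero)       | _ with blocked c p in bp
  ...   | false = digit2 cp bp
  ...   | true  = ⊥-elim (blocked⇒≢2 valid p bp cp)
  digitCase _ p | suc (suc (suc _)) | s≤s (s≤s ())

module DigitBounds where
  open import Data.Bool using (Bool; true; false; if_then_else_)
  open import Data.Nat using (ℕ; zero; suc)
  open import Relation.Binary.PropositionalEquality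

  open DigitStrings

  record DigitArithmetic : Set₁ where
    infix  4 _≤_
    infixl 6 _+_
    infixr 7 _·_
    field
      A           : Set
      0#          : A
      _+_         : A → A → A
      _·_         : ℕ → A → A
      _≤_         : A → A → Set
      ≤-trans     : ∀ {x y z} → x ≤ y → y ≤ z → x ≤ z
      +-monoˡ-≤   : ∀ x {y z} → y ≤ z → y + x ≤ z + x
      +-monoʳ-≤   : ∀ x {y z} → y ≤ z → x + y ≤ x + z
      +-identityˡ : ∀ x → 0# + x ≡ x
      +-identityʳ : ∀ x → x + 0# ≡ x
      0·x≡0       : ∀ x → 0 · x ≡ 0#
      1·x≡x       : ∀ x → 1 · x ≡ x
      2·x≡x+x     : ∀ x → 2 · x ≡ x + x

  module DigitSums (D : DigitArithmetic) where
    open DigitArithmetic D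

    prefix-sum : (ℕ → ℕ) → (ℕ → A) → ℕ → A
    prefix-sum c ω zero    = 0#
    prefix-sum c ω (suc p) = prefix-sum c ω p + c p · ω p

    -- The digit at position j + i is weighted by W (j + i) (k - 1 - i), the second
    -- argument counting the digits of the window that follow it.
    suffix-sum : (ℕ → ℕ) → (ℕ → ℕ → A) → ℕ → ℕ → A
    suffix-sum c W j zero    = 0#
    suffix-sum c W j (suc k) = c j · W j k + suffix-sum c W (suc j) k

    -- In both records, free-d and held-d say that the bound for the state free
    -- (resp. held = blocked) survives reading a digit d.
    record PrefixBounds (ω : ℕ → A) : Set where
      field
        free held : ℕ → A
        start     : 0# ≤ free 0
        free-0    : ∀ p → free p ≤ free (suc p)
        held-0    : ∀ p → held p ≤ free (suc p)
        free-1    : ∀ p → free p + ω p ≤ free (suc p)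
        held-1    : ∀ p → held p + ω p ≤ held (suc p)
        free-2    : ∀ p → free p + (ω p + ω p) ≤ held (suc p)

    record SuffixBounds (W : ℕ → ℕ → A) : Set where
      field
        free held  : ℕ → ℕ → A
        free-start : ∀ j → 0# ≤ free j 0
        held-start : ∀ j → 0# ≤ held j 0
        free-0     : ∀ j k → free (suc j) k ≤ free j (suc k)
        held-0     : ∀ j k → free (suc j) k ≤ held j (suc k)
        free-1     : ∀ j k → W j k + free (suc j) k ≤ free j (suc k)
        held-1     : ∀ j k → W j k + held (suc j) k ≤ held j (suc k)
        free-2     : ∀ j k → W j k + W j k + held (suc j) k ≤ free j (suc k)

    prefix-bound : ∀ {c} → Valid c → ∀ {ω} (bounds : PrefixBounds ω) → let open PrefixBounds bounds in
      ∀ p → prefix-sum c ω p ≤ (if blocked c p then held p else free p)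
    prefix-bound {c} valid {ω} bounds = go
      where
      open PrefixBounds bounds
      go : ∀ p → prefix-sum c ω p ≤ (if blocked c p then held p else free p)
      go zero = start
      go (suc p) with digitCase valid p | go p
      ... | digit0 cp≡0 | ih rewrite cp≡0 | 0·x≡0 (ω p) | +-identityʳ (prefix-sum c ω p) with blocked c p
      ...   | true  = ≤-trans ih (held-0 p)
      ...   | false = ≤-trans ih (free-0 p)
      go (suc p) | digit1 cp≡1 | ih rewrite cp≡1 | 1·x≡x (ω p) with blocked c p
      ...   | true  = ≤-trans (+-monoˡ-≤ (ω p) ih) (held-1 p)
      ...   | false = ≤-trans (+-monoˡ-≤ (ω p) ih) (free-1 p)
      go (suc p) | digit2 cp≡2 free-at-p | ih rewrite cp≡2 | free-at-p | 2·x≡x+x (ω p) =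
        ≤-trans (+-monoˡ-≤ (ω p + ω p) ih) (free-2 p)

    suffix-bound : ∀ {c} → Valid c → ∀ {W} (bounds : SuffixBounds W) → let open SuffixBounds bounds in
      ∀ k j → suffix-sum c W j k ≤ (if blocked c j then held j k else free j k)
    suffix-bound {c} valid {W} bounds = go
      where
      open SuffixBounds bounds
      go : ∀ k j → suffix-sum c W j k ≤ (if blocked c j then held j k else free j k)
      go zero j with blocked c j
      ... | true  = held-start j
      ... | false = free-start j
      go (suc k) j with digitCase valid j | go k (suc j)
      ... | digit0 cj≡0 | ih rewrite cj≡0 | 0·x≡0 (W j k) | +-identityˡ (suffix-sum c W (suc j) k) with blocked c j
      ...   | true  = ≤-trans ih (held-0 j k)
      ...   | false = ≤-trans ih (free-0 j k)
      go (suc k) j | digit1 cj≡1 | ih rewrite cj≡1 | 1·x≡x (W j k) with blocked c j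
      ...   | true  = ≤-trans (+-monoʳ-≤ (W j k) ih) (held-1 j k)
      ...   | false = ≤-trans (+-monoʳ-≤ (W j k) ih) (free-1 j k)
      go (suc k) j | digit2 cj≡2 free-at-j | ih rewrite cj≡2 | free-at-j | 2·x≡x+x (W j k) =
        ≤-trans (+-monoʳ-≤ (W j k + W j k) ih) (free-2 j k)

module IntegerDigitBounds where
  open import Data.Bool using (true; false; if_then_else_)
  open import Data.Integer using (ℤ; +_; 0ℤ; 1ℤ; _+_; _*_; _-_; -_; _≤_; +≤+; nonNegative)
  open import Data.Integer.Properties
  open import Data.Integer.Tactic.RingSolver using (solve-∀)
  open import Data.Nat as ℕ using (ℕ; zero; suc)
  import Data.Nat.Properties as ℕ
  open import Relation.Binary.PropositionalEquality

  open RangeSum +-*-commutativeRing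
  open EvenFibonacci
  open IntegerOrder
  open DigitStrings
  open DigitBounds

  ℤ-digits : DigitArithmetic
  ℤ-digits = record
    { A = ℤ ; 0# = 0ℤ ; _+_ = _+_ ; _·_ = λ n x → + n * x ; _≤_ = _≤_ ; ≤-trans = ≤-trans
    ; +-monoˡ-≤ = +-monoˡ-≤ ; +-monoʳ-≤ = +-monoʳ-≤
    ; +-identityˡ = +-identityˡ ; +-identityʳ = +-identityʳ
    ; 0·x≡0 = *-zeroˡ ; 1·x≡x = *-identityˡ ; 2·x≡x+x = 2*x≡x+x }
    where
    2*x≡x+x : ∀ x → + 2 * x ≡ x + x
    2*x≡x+x = solve-∀

  open DigitSums ℤ-digits public

  prefix-sum≡∑ : ∀ c ω p → prefix-sum c ω p ≡ ∑[ j < p ] (+ c j * ω j)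
  prefix-sum≡∑ c ω zero    = refl
  prefix-sum≡∑ c ω (suc p) = cong (_+ + c p * ω p) (prefix-sum≡∑ c ω p)

  private
    -1-monoˡ : ∀ a x {b} → a + x ≤ b → a - 1ℤ + x ≤ b - 1ℤ
    -1-monoˡ a x {b} a+x≤b = subst (_≤ b - 1ℤ) (algebra a x) (+-monoˡ-≤ (- 1ℤ) a+x≤b)
      where
      algebra : ∀ a x → a + x - 1ℤ ≡ a - 1ℤ + x
      algebra = solve-∀

    -1-monoʳ : ∀ x a {b} → x + a ≤ b → x + (a - 1ℤ) ≤ b - 1ℤ
    -1-monoʳ x a {b} x+a≤b = subst (_≤ b - 1ℤ) (+-assoc x a (- 1ℤ)) (+-monoˡ-≤ (- 1ℤ) x+a≤b)

    -1-mono : ∀ {a b} → a ≤ b → a - 1ℤ ≤ b - 1ℤ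
    -1-mono = +-monoˡ-≤ (- 1ℤ)

    U-suc-suc : ∀ k → U (suc (suc k)) ≡ U (suc k) + (Δ k + U (suc k))
    U-suc-suc k = trans (U-suc (suc k)) (cong (λ x → U (suc k) + x) (Δ-suc k))

    Δ-suc-expanded : ∀ k → Δ (suc k) ≡ Δ k + (U k + Δ k)
    Δ-suc-expanded k = trans (Δ-suc k) (cong (λ x → Δ k + x) (U-suc k))

  value-bound : ∀ {c} → Valid c → ∀ p → ∑[ j < p ] (+ c j * U (suc j)) ≤ U (suc p) - 1ℤ
  value-bound {c} valid p = subst (_≤ U (suc p) - 1ℤ) (prefix-sum≡∑ c (λ j → U (suc j)) p)
    (≤-trans (prefix-bound valid bounds p) (held-dominates (blocked c p)))
    where
    bounds : PrefixBounds (λ j → U (suc j))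
    bounds = record
      { free   = λ p → Δ p - 1ℤ
      ; held   = λ p → U (suc p) - 1ℤ
      ; start  = ≤-refl
      ; free-0 = λ p → -1-mono (Δ-mono p)
      ; held-0 = λ p → -1-mono (U≤Δ (suc p))
      ; free-1 = λ p → -1-monoˡ (Δ p) (U (suc p)) (≤-reflexive (sym (Δ-suc p)))
      ; held-1 = λ p → -1-monoˡ (U (suc p)) (U (suc p)) (U-double (suc p))
      ; free-2 = λ p → -1-monoˡ (Δ p) (U (suc p) + U (suc p))
                         (≤-reflexive (sym (trans (U-suc-suc p) (algebra (U (suc p)) (Δ p)))))
      }
      where
      algebra : ∀ u d → u + (d + u) ≡ d + (u + u)
      algebra = solve-∀
    held-dominates : ∀ b → (if b then U (suc p) - 1ℤ else Δ p - 1ℤ) ≤ U (suc p) - 1ℤ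
    held-dominates true  = ≤-refl
    held-dominates false = -1-mono (Δ≤U-suc p)

  Δ-weighted-bound : ∀ {c} → Valid c → ∀ p → ∑[ j < p ] (+ c j * Δ j) ≤ Δ p
  Δ-weighted-bound {c} valid p = subst (_≤ Δ p) (prefix-sum≡∑ c Δ p)
    (≤-trans (prefix-bound valid bounds p) (held-dominates (blocked c p)))
    where
    bounds : PrefixBounds Δ
    bounds = record
      { free   = U
      ; held   = Δ
      ; start  = U-nonneg 0
      ; free-0 = U-mono
      ; held-0 = Δ≤U-suc
      ; free-1 = λ p → ≤-reflexive (sym (U-suc p))
      ; held-1 = Δ-double
      ; free-2 = λ p → ≤-reflexive (sym (trans (Δ-suc-expanded p) (algebra (U p) (Δ p))))
      }
      where
      algebra : ∀ u d → d + (u + d) ≡ u + (d + d)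
      algebra = solve-∀
    held-dominates : ∀ b → (if b then Δ p else U p) ≤ Δ p
    held-dominates true  = ≤-refl
    held-dominates false = U≤Δ p

  shifted-value-bound : ∀ {c} → Valid c → ∀ p → ∑[ j < p ] (+ c j * U j) ≤ U p
  shifted-value-bound valid zero    = ≤-refl
  shifted-value-bound {c} valid (suc p) = begin
    ∑[ j < suc p ] (+ c j * U j)
      ≡⟨ ∑-front p (λ j → + c j * U j) ⟩
    + c 0 * 0ℤ + ∑[ j < p ] (+ c (suc j) * U (suc j))
      ≡⟨ cong (_+ ∑[ j < p ] (+ c (suc j) * U (suc j))) (*-zeroʳ (+ c 0)) ⟩
    0ℤ + ∑[ j < p ] (+ c (suc j) * U (suc j))
      ≡⟨ +-identityˡ _ ⟩
    ∑[ j < p ] (+ c (suc j) * U (suc j))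
      ≤⟨ value-bound (Valid-shift 1 valid) p ⟩
    U (suc p) - 1ℤ
      ≤⟨ i-j≤i (U (suc p)) 1ℤ ⟩
    U (suc p) ∎
    where open ≤-Reasoning

  suffix-value-bound : ∀ {c} → Valid c → ∀ k j → suffix-sum c (λ _ k → U (suc k)) j k ≤ U (suc k) - 1ℤ
  suffix-value-bound {c} valid k j =
    ≤-trans (suffix-bound valid bounds k j) (free-dominates (blocked c j))
    where
    bounds : SuffixBounds (λ _ k → U (suc k))
    bounds = record
      { free       = λ _ k → U (suc k) - 1ℤ
      ; held       = λ _ k → Δ k - 1ℤ
      ; free-start = λ _ → ≤-refl
      ; held-start = λ _ → ≤-refl
      ; free-0     = λ _ k → -1-mono (U-mono (suc k))
      ; held-0     = λ _ k → -1-mono (U≤Δ (suc k))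
      ; free-1     = λ _ k → -1-monoʳ (U (suc k)) (U (suc k)) (U-double (suc k))
      ; held-1     = λ _ k → -1-monoʳ (U (suc k)) (Δ k) (≤-reflexive (trans (+-comm (U (suc k)) (Δ k)) (sym (Δ-suc k))))
      ; free-2     = λ _ k → -1-monoʳ (U (suc k) + U (suc k)) (Δ k)
                               (≤-reflexive (sym (trans (U-suc-suc k) (algebra (U (suc k)) (Δ k)))))
      }
      where
      algebra : ∀ u d → u + (d + u) ≡ u + u + d
      algebra = solve-∀
    free-dominates : ∀ b → (if b then Δ k - 1ℤ else U (suc k) - 1ℤ) ≤ U (suc k) - 1ℤ
    free-dominates true  = -1-mono (Δ≤U-suc k)
    free-dominates false = ≤-refl

  suffix-Δ-bound : ∀ {c} → Valid c → ∀ k j → suffix-sum c (λ _ → Δ) j k ≤ Δ k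
  suffix-Δ-bound {c} valid k j =
    ≤-trans (suffix-bound valid bounds k j) (free-dominates (blocked c j))
    where
    bounds : SuffixBounds (λ _ → Δ)
    bounds = record
      { free       = λ _ → Δ
      ; held       = λ _ → U
      ; free-start = λ _ → Δ-nonneg 0
      ; held-start = λ _ → U-nonneg 0
      ; free-0     = λ _ → Δ-mono
      ; held-0     = λ _ → Δ≤U-suc
      ; free-1     = λ _ → Δ-double
      ; held-1     = λ _ k → ≤-reflexive (trans (+-comm (Δ k) (U k)) (sym (U-suc k)))
      ; free-2     = λ _ k → ≤-reflexive (sym (trans (Δ-suc-expanded k) (algebra (U k) (Δ k))))
      }
      where
      algebra : ∀ u d → d + (u + d) ≡ d + d + u
      algebra = solve-∀
    free-dominates : ∀ b → (if b then U k else Δ k) ≤ Δ k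
    free-dominates true  = U≤Δ k
    free-dominates false = ≤-refl

  suffix-sum≡∑ : ∀ c W k j → suffix-sum c W j k ≡ ∑[ i < k ] (+ c (j ℕ.+ i) * W (j ℕ.+ i) (k ℕ.∸ suc i))
  suffix-sum≡∑ c W zero    j = refl
  suffix-sum≡∑ c W (suc k) j = begin
    + c j * W j k + suffix-sum c W (suc j) k
      ≡⟨ cong₂ _+_ (cong (λ m → + c m * W m k) (sym (ℕ.+-identityʳ j))) (suffix-sum≡∑ c W k (suc j)) ⟩
    + c (j ℕ.+ 0) * W (j ℕ.+ 0) k + ∑[ i < k ] (+ c (suc j ℕ.+ i) * W (suc j ℕ.+ i) (k ℕ.∸ suc i))
      ≡⟨ cong (λ s → + c (j ℕ.+ 0) * W (j ℕ.+ 0) k + s)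
              (∑-cong k λ i _ → cong (λ m → + c m * W m (k ℕ.∸ suc i)) (sym (ℕ.+-suc j i))) ⟩
    + c (j ℕ.+ 0) * W (j ℕ.+ 0) k + ∑[ i < k ] (+ c (j ℕ.+ suc i) * W (j ℕ.+ suc i) (k ℕ.∸ suc i))
      ≡⟨ ∑-front k (λ i → + c (j ℕ.+ i) * W (j ℕ.+ i) (suc k ℕ.∸ suc i)) ⟨
    ∑[ i < suc k ] (+ c (j ℕ.+ i) * W (j ℕ.+ i) (suc k ℕ.∸ suc i)) ∎
    where open ≡-Reasoning

  suffix-sum-nonneg : ∀ c {W} → (∀ j k → 0ℤ ≤ W j k) → ∀ k j → 0ℤ ≤ suffix-sum c W j k
  suffix-sum-nonneg c 0≤W zero    j = ≤-refl
  suffix-sum-nonneg c {W} 0≤W (suc k) j =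
    nonneg-+ (digit-nonneg (c j) (0≤W j k)) (suffix-sum-nonneg c 0≤W k (suc j))

module DigitDifferences where
  open import Data.Empty using (⊥-elim)
  open import Data.Integer as ℤ using (ℤ; +_; 0ℤ; 1ℤ; _+_; _*_; _-_; -_; _≤_; +≤+; nonNegative)
  open import Data.Integer.Properties
  open import Data.Integer.Tactic.RingSolver using (solve-∀)
  open import Data.Nat as ℕ using (ℕ; zero; suc; _∸_; _<_)
  import Data.Nat.Properties as ℕ
  open import Data.Product using (Σ; _×_; _,_)
  open import Data.Sum using (_⊎_; inj₁; inj₂)
  open import Relation.Binary.PropositionalEquality
  open import Relation.Nullary using (yes; no)
  open import Relation.Binary using (tri<; tri≈; tri>)

  open RangeSum +-*-commutativeRing
  open DigitStrings
  open IntegerOrder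
  open IntegerDigitBounds using (suffix-sum; suffix-sum≡∑; suffix-sum-nonneg)

  -- Opaque, so that unification does not unfold the integer subtraction.
  opaque
    diff : (ℕ → ℕ) → (ℕ → ℕ) → ℕ → ℤ
    diff c c′ j = + c j - + c′ j

    diff-def : ∀ c c′ j → diff c c′ j ≡ + c j - + c′ j
    diff-def c c′ j = refl

    diff-shift : ∀ c c′ κ i → diff (λ i → c (κ ℕ.+ i)) (λ i → c′ (κ ℕ.+ i)) i ≡ diff c c′ (κ ℕ.+ i)
    diff-shift c c′ κ i = refl

    diff-*-distrib : ∀ c c′ j w → diff c c′ j * w ≡ + c j * w - + c′ j * w
    diff-*-distrib c c′ j w = algebra (+ c j) (+ c′ j) w
      where
      algebra : ∀ a b w → (a - b) * w ≡ a * w - b * w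
      algebra = solve-∀

    diff-agree : ∀ {c c′ j} → c j ≡ c′ j → diff c c′ j ≡ 0ℤ
    diff-agree {c′ = c′} {j} cj≡c′j rewrite cj≡c′j = +-inverseʳ (+ c′ j)

    diff-pos : ∀ {c c′ j} → c′ j ℕ.< c j → 1ℤ ≤ diff c c′ j
    diff-pos {c} {c′} {j} c′j<cj = begin
      1ℤ                         ≤⟨ +≤+ (ℕ.m<n⇒0<n∸m c′j<cj) ⟩
      + (c j ∸ c′ j)             ≡⟨ ⊖-≥ (ℕ.<⇒≤ c′j<cj) ⟨
      c j ℤ.⊖ c′ j               ≡⟨ m-n≡m⊖n (c j) (c′ j) ⟨
      diff c c′ j ∎
      where open ≤-Reasoning

    diff-swap : ∀ c c′ j → diff c′ c j ≡ - diff c c′ j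
    diff-swap c c′ j = algebra (+ c j) (+ c′ j)
      where
      algebra : ∀ x y → y - x ≡ - (x - y)
      algebra = solve-∀

    diff-≤ : ∀ c c′ j → diff c c′ j ≤ + c j
    diff-≤ c c′ j = i-j≤i (+ c j) (+ c′ j)

  data LexGE (n : ℕ) (c c′ : ℕ → ℕ) : Set where
    lex-eq : (∀ j → j < n → c j ≡ c′ j) → LexGE n c c′
    lex-gt : ∀ K → K < n → c′ K ℕ.< c K → (∀ j → K < j → j < n → c j ≡ c′ j) → LexGE n c c′

  private
    nothing-above : ∀ {d d′ : ℕ → ℕ} n j → n < j → j < suc n → d j ≡ d′ j
    nothing-above n j n<j j<1+n = ⊥-elim (ℕ.<-irrefl refl (ℕ.<-≤-trans n<j (ℕ.≤-pred j<1+n)))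

    lex-extend : ∀ {n d d′} → d n ≡ d′ n → LexGE n d d′ → LexGE (suc n) d d′
    lex-extend {n} {d} {d′} dn≡d′n (lex-eq agree) = lex-eq agree′
      where
      agree′ : ∀ j → j < suc n → d j ≡ d′ j
      agree′ j j<1+n with ℕ.m<1+n⇒m<n∨m≡n j<1+n
      ... | inj₁ j<n  = agree j j<n
      ... | inj₂ refl = dn≡d′n
    lex-extend {n} {d} {d′} dn≡d′n (lex-gt K K<n lt above) = lex-gt K (ℕ.m<n⇒m<1+n K<n) lt above′
      where
      above′ : ∀ j → K < j → j < suc n → d j ≡ d′ j
      above′ j K<j j<1+n with ℕ.m<1+n⇒m<n∨m≡n j<1+n
      ... | inj₁ j<n  = above j K<j j<n
      ... | inj₂ refl = dn≡d′n

  lex-total : ∀ n c c′ → LexGE n c c′ ⊎ LexGE n c′ c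
  lex-total zero    c c′ = inj₁ (lex-eq λ _ ())
  lex-total (suc n) c c′ with ℕ.<-cmp (c n) (c′ n)
  ... | tri< cn<c′n _ _ = inj₂ (lex-gt n ℕ.≤-refl cn<c′n (nothing-above n))
  ... | tri> _ _ c′n<cn = inj₁ (lex-gt n ℕ.≤-refl c′n<cn (nothing-above n))
  ... | tri≈ _ cn≡c′n _ with lex-total n c c′
  ...   | inj₁ ge = inj₁ (lex-extend cn≡c′n ge)
  ...   | inj₂ le = inj₂ (lex-extend (sym cn≡c′n) le)

  private
    shift-< : ∀ κ {j n} → j < n ∸ κ → κ ℕ.+ j < n
    shift-< zero            j<n  = j<n
    shift-< (suc κ) {n = suc n} j<n∸κ = ℕ.s≤s (shift-< κ j<n∸κ)

  lex-shift : ∀ {n c c′} κ → LexGE n c c′ → LexGE (n ∸ κ) (λ i → c (κ ℕ.+ i)) (λ i → c′ (κ ℕ.+ i))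
  lex-shift κ (lex-eq agree) = lex-eq λ j j<n∸κ → agree (κ ℕ.+ j) (shift-< κ j<n∸κ)
  lex-shift {n} {c} {c′} κ (lex-gt K K<n lt above) with κ ℕ.≤? K
  ... | yes κ≤K = lex-gt (K ∸ κ) (ℕ.∸-monoˡ-< K<n κ≤K) lt′ above′
    where
    κ+[K∸κ]≡K : κ ℕ.+ (K ∸ κ) ≡ K
    κ+[K∸κ]≡K = ℕ.m+[n∸m]≡n κ≤K
    lt′ : c′ (κ ℕ.+ (K ∸ κ)) ℕ.< c (κ ℕ.+ (K ∸ κ))
    lt′ rewrite κ+[K∸κ]≡K = lt
    above′ : ∀ j → K ∸ κ < j → j < n ∸ κ → c (κ ℕ.+ j) ≡ c′ (κ ℕ.+ j)
    above′ j K∸κ<j j<n∸κ =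
      above (κ ℕ.+ j) (subst (_< κ ℕ.+ j) κ+[K∸κ]≡K (ℕ.+-monoʳ-< κ K∸κ<j)) (shift-< κ j<n∸κ)
  ... | no κ≰K = lex-eq λ j j<n∸κ →
    above (κ ℕ.+ j) (ℕ.<-≤-trans (ℕ.≰⇒> κ≰K) (ℕ.m≤m+n κ j)) (shift-< κ j<n∸κ)

  PrefixDominated : (ℕ → ℤ) → Set
  PrefixDominated ω = ∀ d → Valid d → ∀ p → ∑[ j < p ] (+ d j * ω j) ≤ ω p

  lex-sum-nonneg : ∀ {n c c′} → Valid c′ → LexGE n c c′ →
    ∀ ω → (∀ j → 0ℤ ≤ ω j) → PrefixDominated ω → 0ℤ ≤ ∑[ j < n ] (diff c c′ j * ω j)
  lex-sum-nonneg {n} {c} {c′} _ (lex-eq agree) ω _ _ =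
    ≤-reflexive (sym (∑-zero n λ j j<n → trans (cong (_* ω j) (diff-agree (agree j j<n))) (*-zeroˡ (ω j))))
  lex-sum-nonneg {n} {c} {c′} valid′ (lex-gt K K<n c′K<cK above) ω 0≤ω dominated = begin
    0ℤ
      ≤⟨ nonneg-+ (nonneg-+ X-nonneg (i≤j⇒0≤j-i Y≤ωK)) (nonneg-* (i≤j⇒0≤j-i (diff-pos c′K<cK)) (0≤ω K)) ⟩
    X + (ω K - Y) + (diff c c′ K - 1ℤ) * ω K
      ≡⟨ algebra X Y (diff c c′ K) (ω K) ⟩
    X - Y + diff c c′ K * ω K
      ≡⟨ cong (_+ f K) (∑-distrib-sub K _ _) ⟨
    ∑[ j < K ] (+ c j * ω j - + c′ j * ω j) + f K
      ≡⟨ cong (_+ f K) (∑-cong K λ j _ → diff-*-distrib c c′ j (ω j)) ⟨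
    ∑ (suc K) f
      ≡⟨ drop-agreeing-top ⟨
    ∑ n f ∎
    where
    open ≤-Reasoning
    f : ℕ → ℤ
    f j = diff c c′ j * ω j
    X Y : ℤ
    X = ∑[ j < K ] (+ c j * ω j)
    Y = ∑[ j < K ] (+ c′ j * ω j)
    X-nonneg : 0ℤ ≤ X
    X-nonneg = ∑-nonneg K λ j _ → digit-nonneg (c j) (0≤ω j)
    Y≤ωK : Y ≤ ω K
    Y≤ωK = dominated c′ valid′ K
    drop-agreeing-top : ∑ n f ≡ ∑ (suc K) f
    drop-agreeing-top =
      trans (cong (λ m → ∑ m f) (sym (ℕ.m+[n∸m]≡n K<n))) (∑-zero-tail (suc K) (n ∸ suc K) f agreeing)
      where
      agreeing : ∀ i → i < n ∸ suc K → f (suc K ℕ.+ i) ≡ 0ℤ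
      agreeing i i<n∸1+K =
        trans (cong (_* ω (suc K ℕ.+ i)) (diff-agree (above (suc K ℕ.+ i) (ℕ.s≤s (ℕ.m≤m+n K i)) (shift-< (suc K) i<n∸1+K))))
              (*-zeroˡ (ω (suc K ℕ.+ i)))
    algebra : ∀ x y e w → x + (w - y) + (e - 1ℤ) * w ≡ x - y + e * w
    algebra = solve-∀

  lex-sum-nonneg-shifted : ∀ {n c c′} → Valid c′ → LexGE n c c′ →
    ∀ ω → (∀ j → 0ℤ ≤ ω j) → PrefixDominated ω → ∀ κ → 0ℤ ≤ ∑[ i < n ∸ κ ] (diff c c′ (κ ℕ.+ i) * ω i)
  lex-sum-nonneg-shifted {n} {c} {c′} valid′ ge ω 0≤ω dominated κ =
    subst (0ℤ ≤_) (∑-cong (n ∸ κ) λ i _ → cong (_* ω i) (diff-shift c c′ κ i))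
          (lex-sum-nonneg (Valid-shift κ valid′) (lex-shift κ ge) ω 0≤ω dominated)

  diff-sum-swap : ∀ n c c′ (g : ℕ → ℕ) (ω : ℕ → ℤ) →
    ∑[ j < n ] (diff c′ c (g j) * ω j) ≡ - ∑[ j < n ] (diff c c′ (g j) * ω j)
  diff-sum-swap n c c′ g ω = trans
    (∑-cong n λ j _ → trans (cong (_* ω j) (diff-swap c c′ (g j))) (sym (neg-distribˡ-* (diff c c′ (g j)) (ω j))))
    (∑-distrib-neg n _)

  SuffixDominated : (ℕ → ℤ) → (ℕ → ℤ) → Set
  SuffixDominated Ω bound = ∀ d → Valid d → ∀ k j → suffix-sum d (λ _ → Ω) j k ≤ bound k

  record BottomLead (c c′ : ℕ → ℕ) : Set where
    field
      position    : ℕ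
      agree-below : ∀ i → i < position → c i ≡ c′ i
      lead        : c′ position ℕ.< c position

  module _ {c c′ : ℕ → ℕ} (valid′ : Valid c′) (Ω bound : ℕ → ℤ) (0≤Ω : ∀ k → 0ℤ ≤ Ω k)
           (dominated : SuffixDominated Ω bound) where

    private
      S : (ℕ → ℕ) → ℕ → ℕ → ℤ
      S d = suffix-sum d (λ _ → Ω)

      lead-gap : ∀ {δ} → (∀ k → δ + bound k ≤ Ω k) → ∀ m j k → (∀ i → i < m → c (j ℕ.+ i) ≡ c′ (j ℕ.+ i)) →
        c′ (j ℕ.+ m) ℕ.< c (j ℕ.+ m) → δ ≤ S c j (m ℕ.+ suc k) - S c′ j (m ℕ.+ suc k)
      lead-gap {δ} gap zero j k _ lt rewrite ℕ.+-identityʳ j =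
        ≤-of-gap _ (nonneg-+ (nonneg-+ (nonneg-+ (i≤j⇒0≤j-i (gap k)) (i≤j⇒0≤j-i (dominated c′ valid′ k (suc j))))
                                       (nonneg-* (i≤j⇒0≤j-i (subst (1ℤ ≤_) (diff-def c c′ j) (diff-pos lt))) (0≤Ω k)))
                             (suffix-sum-nonneg c (λ _ → 0≤Ω) k (suc j)))
                   (algebra δ (bound k) (Ω k) (+ c j) (+ c′ j) (S c (suc j) k) (S c′ (suc j) k))
        where
        algebra : ∀ δ b w x x′ s s′ → x * w + s - (x′ * w + s′) ≡ δ + ((w - (δ + b)) + (b - s′) + (x - x′ - 1ℤ) * w + s)
        algebra = solve-∀
      lead-gap {δ} gap (suc m) j k agree lt = subst (δ ≤_) (sym cancel-agreeing) (lead-gap gap m (suc j) k agree′ lt′)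
        where
        cj≡c′j : c j ≡ c′ j
        cj≡c′j = subst (λ i → c i ≡ c′ i) (ℕ.+-identityʳ j) (agree 0 (ℕ.s≤s ℕ.z≤n))
        agree′ : ∀ i → i < m → c (suc j ℕ.+ i) ≡ c′ (suc j ℕ.+ i)
        agree′ i i<m = subst (λ l → c l ≡ c′ l) (ℕ.+-suc j i) (agree (suc i) (ℕ.s≤s i<m))
        lt′ : c′ (suc j ℕ.+ m) ℕ.< c (suc j ℕ.+ m)
        lt′ = subst (λ l → c′ l ℕ.< c l) (ℕ.+-suc j m) lt
        cancel-agreeing : S c j (suc m ℕ.+ suc k) - S c′ j (suc m ℕ.+ suc k)
                        ≡ S c (suc j) (m ℕ.+ suc k) - S c′ (suc j) (m ℕ.+ suc k)
        cancel-agreeing rewrite cj≡c′j =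
          algebra (+ c′ j * Ω (m ℕ.+ suc k)) (S c (suc j) (m ℕ.+ suc k)) (S c′ (suc j) (m ℕ.+ suc k))
          where
          algebra : ∀ x s s′ → x + s - (x + s′) ≡ s - s′
          algebra = solve-∀

    reversed-sum≡ : ∀ κ → ∑[ j < κ ] (diff c c′ j * Ω (κ ∸ suc j)) ≡ S c 0 κ - S c′ 0 κ
    reversed-sum≡ κ = begin
      ∑[ j < κ ] (diff c c′ j * Ω (κ ∸ suc j))
        ≡⟨ ∑-cong κ (λ j _ → diff-*-distrib c c′ j _) ⟩
      ∑[ j < κ ] (+ c j * Ω (κ ∸ suc j) - + c′ j * Ω (κ ∸ suc j))
        ≡⟨ ∑-distrib-sub κ _ _ ⟩
      ∑[ j < κ ] (+ c j * Ω (κ ∸ suc j)) - ∑[ j < κ ] (+ c′ j * Ω (κ ∸ suc j))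
        ≡⟨ cong₂ _-_ (suffix-sum≡∑ c _ κ 0) (suffix-sum≡∑ c′ _ κ 0) ⟨
      S c 0 κ - S c′ 0 κ ∎
      where open ≡-Reasoning

    bottom-sum : ∀ {δ} → (∀ k → δ + bound k ≤ Ω k) → (bl : BottomLead c c′) →
      ∀ κ → BottomLead.position bl < κ → δ ≤ ∑[ j < κ ] (diff c c′ j * Ω (κ ∸ suc j))
    bottom-sum {δ} gap bl κ m<κ = subst (δ ≤_) (sym (reversed-sum≡ κ))
      (subst (λ κ → δ ≤ S c 0 κ - S c′ 0 κ) (trans (ℕ.+-suc m _) (ℕ.m+[n∸m]≡n m<κ))
             (lead-gap gap m 0 (κ ∸ suc m) agree-below lead))
      where open BottomLead bl renaming (position to m)

    bottom-sum-nonneg : (∀ k → bound k ≤ Ω k) → BottomLead c c′ →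
      ∀ κ → 0ℤ ≤ ∑[ j < κ ] (diff c c′ j * Ω (κ ∸ suc j))
    bottom-sum-nonneg bound≤Ω bl κ with BottomLead.position bl ℕ.<? κ
    ... | yes m<κ = bottom-sum (λ k → subst (_≤ Ω k) (sym (+-identityˡ (bound k))) (bound≤Ω k)) bl κ m<κ
    ... | no  m≮κ = ≤-reflexive (sym (∑-zero κ λ j j<κ →
            trans (cong (_* Ω (κ ∸ suc j)) (diff-agree (BottomLead.agree-below bl j (ℕ.<-≤-trans j<κ (ℕ.≮⇒≥ m≮κ)))))
                  (*-zeroˡ (Ω (κ ∸ suc j)))))

  first-difference : ∀ n c c′ → (∀ j → j < n → c j ≡ c′ j)
    ⊎ Σ (BottomLead c c′) (λ bl → BottomLead.position bl < n)
    ⊎ Σ (BottomLead c′ c) (λ bl → BottomLead.position bl < n)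
  first-difference zero    c c′ = inj₁ λ _ ()
  first-difference (suc n) c c′ with first-difference n c c′
  ... | inj₂ (inj₁ (bl , m<n)) = inj₂ (inj₁ (bl , ℕ.m<n⇒m<1+n m<n))
  ... | inj₂ (inj₂ (bl , m<n)) = inj₂ (inj₂ (bl , ℕ.m<n⇒m<1+n m<n))
  ... | inj₁ agree with ℕ.<-cmp (c n) (c′ n)
  ...   | tri< cn<c′n _ _ =
    inj₂ (inj₂ (record { position = n ; agree-below = λ i i<n → sym (agree i i<n) ; lead = cn<c′n } , ℕ.≤-refl))
  ...   | tri> _ _ c′n<cn =
    inj₂ (inj₁ (record { position = n ; agree-below = agree ; lead = c′n<cn } , ℕ.≤-refl))
  ...   | tri≈ _ cn≡c′n _ = inj₁ agree′
    where
    agree′ : ∀ j → j < suc n → c j ≡ c′ j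
    agree′ j j<1+n with ℕ.m<1+n⇒m<n∨m≡n j<1+n
    ... | inj₁ j<n  = agree j j<n
    ... | inj₂ refl = cn≡c′n

  diff-sum-≤ : ∀ n c c′ (ω : ℕ → ℤ) → (∀ j → 0ℤ ≤ ω j) →
    ∑[ j < n ] (diff c c′ j * ω j) ≤ ∑[ j < n ] (+ c j * ω j)
  diff-sum-≤ zero    c c′ ω 0≤ω = ≤-refl
  diff-sum-≤ (suc n) c c′ ω 0≤ω =
    +-mono-≤ (diff-sum-≤ n c c′ ω 0≤ω) (*-monoʳ-≤-nonNeg (ω n) {{nonNegative (0≤ω n)}} (diff-≤ c c′ n))

module RationalEmbedding where
  open import Data.Integer as ℤ using (ℤ; 0ℤ; 1ℤ)
  import Data.Integer.Properties as ℤ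
  open import Data.Integer.Tactic.RingSolver using (solve-∀)
  open import Relation.Nullary.Decidable using (dec⇒maybe)
  open import Level using (0ℓ)
  open import Tactic.RingSolver.Core.AlmostCommutativeRing using (AlmostCommutativeRing; fromCommutativeRing)
  open import Data.Nat as ℕ using (ℕ; zero; suc)
  import Data.Nat.Properties as ℕ
  open import Data.Rational
  open import Data.Rational.Properties
  open import Data.Rational.Unnormalised as ℚᵘ using (mkℚᵘ; *≡*; *≤*; *<*)
  import Data.Rational.Unnormalised.Properties as ℚᵘ
  open import Relation.Binary.PropositionalEquality

  open RangeSum +-*-commutativeRing public
  private module ℤ∑ = RangeSum ℤ.+-*-commutativeRing

  ℚ-ring : AlmostCommutativeRing 0ℓ 0ℓ
  ℚ-ring = fromCommutativeRing +-*-commutativeRing (λ x → dec⇒maybe (0ℚ ≟ x))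

  -- Opaque, so that terms such as ι (U k) are not normalised during unification.
  opaque
    ι : ℤ → ℚ
    ι z = z / 1

    ι-0 : ι 0ℤ ≡ 0ℚ
    ι-0 = refl

    ι-1 : ι 1ℤ ≡ 1ℚ
    ι-1 = refl

    private
      toℚᵘ-ι : ∀ z → toℚᵘ (ι z) ℚᵘ.≃ mkℚᵘ z 0
      toℚᵘ-ι z = toℚᵘ-fromℚᵘ (mkℚᵘ z 0)

    ι-+ : ∀ x y → ι (x ℤ.+ y) ≡ ι x + ι y
    ι-+ x y = toℚᵘ-injective (begin
      toℚᵘ (ι (x ℤ.+ y))          ≈⟨ toℚᵘ-ι (x ℤ.+ y) ⟩
      mkℚᵘ (x ℤ.+ y) 0            ≈⟨ *≡* (algebra x y) ⟨
      mkℚᵘ x 0 ℚᵘ.+ mkℚᵘ y 0      ≈⟨ ℚᵘ.+-cong (toℚᵘ-ι x) (toℚᵘ-ι y) ⟨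
      toℚᵘ (ι x) ℚᵘ.+ toℚᵘ (ι y)  ≈⟨ toℚᵘ-homo-+ (ι x) (ι y) ⟨
      toℚᵘ (ι x + ι y)            ∎)
      where
      open ℚᵘ.≃-Reasoning
      algebra : ∀ x y → (x ℤ.* 1ℤ ℤ.+ y ℤ.* 1ℤ) ℤ.* 1ℤ ≡ (x ℤ.+ y) ℤ.* (1ℤ ℤ.* 1ℤ)
      algebra = solve-∀

    ι-* : ∀ x y → ι (x ℤ.* y) ≡ ι x * ι y
    ι-* x y = toℚᵘ-injective (begin
      toℚᵘ (ι (x ℤ.* y))          ≈⟨ toℚᵘ-ι (x ℤ.* y) ⟩
      mkℚᵘ (x ℤ.* y) 0            ≈⟨ *≡* (algebra x y) ⟨
      mkℚᵘ x 0 ℚᵘ.* mkℚᵘ y 0      ≈⟨ ℚᵘ.*-cong (toℚᵘ-ι x) (toℚᵘ-ι y) ⟨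
      toℚᵘ (ι x) ℚᵘ.* toℚᵘ (ι y)  ≈⟨ toℚᵘ-homo-* (ι x) (ι y) ⟨
      toℚᵘ (ι x * ι y)            ∎)
      where
      open ℚᵘ.≃-Reasoning
      algebra : ∀ x y → (x ℤ.* y) ℤ.* 1ℤ ≡ (x ℤ.* y) ℤ.* (1ℤ ℤ.* 1ℤ)
      algebra = solve-∀

    ι-mono-≤ : ∀ {x y} → x ℤ.≤ y → ι x ≤ ι y
    ι-mono-≤ {x} {y} x≤y = toℚᵘ-cancel-≤ (ℚᵘ.≤-respʳ-≃ (ℚᵘ.≃-sym (toℚᵘ-ι y)) (ℚᵘ.≤-respˡ-≃ (ℚᵘ.≃-sym (toℚᵘ-ι x))
      (*≤* (subst₂ ℤ._≤_ (sym (ℤ.*-identityʳ x)) (sym (ℤ.*-identityʳ y)) x≤y))))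

    ι-mono-< : ∀ {x y} → x ℤ.< y → ι x < ι y
    ι-mono-< {x} {y} x<y = toℚᵘ-cancel-< (ℚᵘ.<-respʳ-≃ (ℚᵘ.≃-sym (toℚᵘ-ι y)) (ℚᵘ.<-respˡ-≃ (ℚᵘ.≃-sym (toℚᵘ-ι x))
      (*<* (subst₂ ℤ._<_ (sym (ℤ.*-identityʳ x)) (sym (ℤ.*-identityʳ y)) x<y))))

    frac-*-ι : ∀ i n .{{_ : ℕ.NonZero n}} → (i / n) * ι (ℤ.+ n) ≡ ι i
    frac-*-ι i n@(suc n-1) = toℚᵘ-injective (begin
      toℚᵘ ((i / n) * ι (ℤ.+ n))            ≈⟨ toℚᵘ-homo-* (i / n) (ι (ℤ.+ n)) ⟩
      toℚᵘ (i / n) ℚᵘ.* toℚᵘ (ι (ℤ.+ n))    ≈⟨ ℚᵘ.*-cong (toℚᵘ-fromℚᵘ (mkℚᵘ i n-1)) (toℚᵘ-ι (ℤ.+ n)) ⟩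
      mkℚᵘ i n-1 ℚᵘ.* mkℚᵘ (ℤ.+ n) 0        ≈⟨ *≡* cross ⟩
      mkℚᵘ i 0                              ≈⟨ toℚᵘ-ι i ⟨
      toℚᵘ (ι i)                            ∎)
      where
      open ℚᵘ.≃-Reasoning
      cross : (i ℤ.* ℤ.+ n) ℤ.* 1ℤ ≡ i ℤ.* ℤ.+ suc (n-1 ℕ.* 1)
      cross = trans (ℤ.*-identityʳ _) (cong (λ m → i ℤ.* ℤ.+ suc m) (sym (ℕ.*-identityʳ n-1)))

  ι-3 : ι (ℤ.+ 3) ≡ 1ℚ + 1ℚ + 1ℚ
  ι-3 = trans (ι-+ (1ℤ ℤ.+ 1ℤ) 1ℤ) (cong₂ _+_ (trans (ι-+ 1ℤ 1ℤ) (cong₂ _+_ ι-1 ι-1)) ι-1)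

  ι-nonneg : ∀ {x} → 0ℤ ℤ.≤ x → 0ℚ ≤ ι x
  ι-nonneg {x} 0≤x = subst (_≤ ι x) ι-0 (ι-mono-≤ 0≤x)

  ι-neg : ∀ x → ι (ℤ.- x) ≡ - ι x
  ι-neg x = begin
    ι (ℤ.- x)                   ≡⟨ +-identityʳ _ ⟨
    ι (ℤ.- x) + 0ℚ              ≡⟨ cong (ι (ℤ.- x) +_) (+-inverseʳ (ι x)) ⟨
    ι (ℤ.- x) + (ι x - ι x)     ≡⟨ +-assoc (ι (ℤ.- x)) (ι x) (- ι x) ⟨
    ι (ℤ.- x) + ι x - ι x       ≡⟨ cong (_- ι x) (ι-+ (ℤ.- x) x) ⟨
    ι (ℤ.- x ℤ.+ x) - ι x       ≡⟨ cong (λ z → ι z - ι x) (ℤ.+-inverseˡ x) ⟩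
    ι 0ℤ - ι x                  ≡⟨ cong (_- ι x) ι-0 ⟩
    0ℚ - ι x                    ≡⟨ +-identityˡ _ ⟩
    - ι x                       ∎
    where open ≡-Reasoning

  ι-- : ∀ x y → ι (x ℤ.- y) ≡ ι x - ι y
  ι-- x y = trans (ι-+ x (ℤ.- y)) (cong (ι x +_) (ι-neg y))

  ι-det : ∀ a b c d → ι (a ℤ.* b ℤ.- c ℤ.* d) ≡ ι a * ι b - ι c * ι d
  ι-det a b c d = trans (ι-- (a ℤ.* b) (c ℤ.* d)) (cong₂ _-_ (ι-* a b) (ι-* c d))

  ι-∑ : ∀ n f → ι (ℤ∑.∑ n f) ≡ ∑[ j < n ] ι (f j)
  ι-∑ zero    f = ι-0
  ι-∑ (suc n) f = trans (ι-+ (ℤ∑.∑ n f) (f n)) (cong (_+ ι (f n)) (ι-∑ n f))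

  nonneg-+ : ∀ {x y} → 0ℚ ≤ x → 0ℚ ≤ y → 0ℚ ≤ x + y
  nonneg-+ 0≤x 0≤y = +-mono-≤ 0≤x 0≤y

  nonneg-* : ∀ {x y} → 0ℚ ≤ x → 0ℚ ≤ y → 0ℚ ≤ x * y
  nonneg-* {x} {y} 0≤x 0≤y = subst (_≤ x * y) (*-zeroˡ y) (*-monoʳ-≤-nonNeg y {{nonNegative 0≤y}} 0≤x)

  pos-+ : ∀ {x y} → 0ℚ < x → 0ℚ < y → 0ℚ < x + y
  pos-+ 0<x 0<y = +-mono-< 0<x 0<y

  pos-* : ∀ {x y} → 0ℚ < x → 0ℚ < y → 0ℚ < x * y
  pos-* {x} {y} 0<x 0<y = positive⁻¹ (x * y) {{pos*pos⇒pos x {{positive 0<x}} y {{positive 0<y}}}}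

  nonpos-* : ∀ {x y} → x ≤ 0ℚ → 0ℚ ≤ y → x * y ≤ 0ℚ
  nonpos-* {x} {y} x≤0 0≤y = subst (x * y ≤_) (*-zeroˡ y) (*-monoʳ-≤-nonNeg y {{nonNegative 0≤y}} x≤0)

  ≤-of-gap : ∀ {x y} d → 0ℚ ≤ d → y ≡ x + d → x ≤ y
  ≤-of-gap {x} d 0≤d refl = subst (_≤ x + d) (+-identityʳ x) (+-monoʳ-≤ x 0≤d)

  <-of-gap : ∀ {x y} d → 0ℚ < d → y ≡ x + d → x < y
  <-of-gap {x} d 0<d refl = subst (_< x + d) (+-identityʳ x) (+-monoʳ-< x 0<d)

  p≤q⇒0≤q-p : ∀ {p q} → p ≤ q → 0ℚ ≤ q - p
  p≤q⇒0≤q-p {p} {q} p≤q = subst (_≤ q - p) (+-inverseʳ p) (+-monoˡ-≤ (- p) p≤q)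

  p<q⇒0<q-p : ∀ {p q} → p < q → 0ℚ < q - p
  p<q⇒0<q-p {p} {q} p<q = subst (_< q - p) (+-inverseʳ p) (+-monoˡ-< (- p) p<q)

  ∑-mono-≤ : ∀ n {f g : ℕ → ℚ} → (∀ i → i ℕ.< n → f i ≤ g i) → ∑ n f ≤ ∑ n g
  ∑-mono-≤ zero    f≤g = ≤-refl
  ∑-mono-≤ (suc n) f≤g = +-mono-≤ (∑-mono-≤ n λ i i<n → f≤g i (ℕ.m<n⇒m<1+n i<n)) (f≤g n ℕ.≤-refl)

  ∑-nonneg : ∀ n {f : ℕ → ℚ} → (∀ i → i ℕ.< n → 0ℚ ≤ f i) → 0ℚ ≤ ∑ n f
  ∑-nonneg n {f} 0≤f = subst (_≤ ∑ n f) (∑-zero n (λ _ _ → refl)) (∑-mono-≤ n 0≤f)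

  ∑-nonpos : ∀ n {f : ℕ → ℚ} → (∀ i → i ℕ.< n → f i ≤ 0ℚ) → ∑ n f ≤ 0ℚ
  ∑-nonpos n {f} f≤0 = subst (∑ n f ≤_) (∑-zero n (λ _ _ → refl)) (∑-mono-≤ n f≤0)

module Reciprocals where
  open import Data.Integer as ℤ using (ℤ; +_; 0ℤ; 1ℤ)
  import Data.Integer.Properties as ℤ
  open import Data.Nat as ℕ using (ℕ; zero; suc)
  import Data.Nat.Properties as ℕ
  open import Data.Rational
  open import Data.Rational.Properties
  open import Relation.Binary.PropositionalEquality
  open import Tactic.RingSolver using (solve-∀)

  open EvenFibonacci
  open RationalEmbedding

  u-pos : ∀ j → 0ℚ < ι (U (suc j))
  u-pos j = subst (_< ι (U (suc j))) ι-0 (ι-mono-< (ℤ.suc[i]≤j⇒i<j {i = 0ℤ} (U-suc-pos j)))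

  u-nonZero : ∀ j → NonZero (ι (U (suc j)))
  u-nonZero j = >-nonZero (u-pos j)

  r : ℕ → ℚ
  r j = (1/ ι (U (suc j))) {{u-nonZero j}}

  u*r≡1 : ∀ j → ι (U (suc j)) * r j ≡ 1ℚ
  u*r≡1 j = *-inverseʳ (ι (U (suc j))) {{u-nonZero j}}

  r-pos : ∀ j → 0ℚ < r j
  r-pos j = positive⁻¹ (r j) {{1/pos⇒pos (ι (U (suc j))) {{positive (u-pos j)}}}}

  r-nonneg : ∀ j → 0ℚ ≤ r j
  r-nonneg j = <⇒≤ (r-pos j)

  w : ℕ → ℚ
  w t = r t * r (suc t)

  w-nonneg : ∀ t → 0ℚ ≤ w t
  w-nonneg t = nonneg-* (r-nonneg t) (r-nonneg (suc t))

  telescoping : ∀ j d → ∑[ t < d ] w (j ℕ.+ t) ≡ ι (U d) * r j * r (j ℕ.+ d)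
  telescoping j zero    = sym (trans (cong (λ x → x * r j * r (j ℕ.+ 0)) ι-0)
                                     (trans (cong (_* r (j ℕ.+ 0)) (*-zeroˡ (r j))) (*-zeroˡ (r (j ℕ.+ 0)))))
  telescoping j (suc d) = begin
    ∑[ t < d ] w (j ℕ.+ t) + ρb * ρb′
      ≡⟨ cong (_+ ρb * ρb′) (telescoping j d) ⟩
    x * ρa * ρb + ρb * ρb′
      ≡⟨ algebra₁ x ρa ρb ρb′ ⟩
    x * ρa * ρb * 1ℚ + 1ℚ * ρb * ρb′
      ≡⟨ cong₂ (λ s t → x * ρa * ρb * s + t * ρb * ρb′) (sym (u*r≡1 (suc (j ℕ.+ d)))) (sym (u*r≡1 j)) ⟩
    x * ρa * ρb * (b′ * ρb′) + a * ρa * ρb * ρb′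
      ≡⟨ cong (λ t → x * ρa * ρb * (b′ * ρb′) + t * ρa * ρb * ρb′) casoratian′ ⟨
    x * ρa * ρb * (b′ * ρb′) + (x′ * b - x * b′) * ρa * ρb * ρb′
      ≡⟨ algebra₂ b b′ x x′ ρa ρb ρb′ ⟩
    x′ * ρa * ρb′ * (b * ρb)
      ≡⟨ cong (x′ * ρa * ρb′ *_) (u*r≡1 (j ℕ.+ d)) ⟩
    x′ * ρa * ρb′ * 1ℚ
      ≡⟨ *-identityʳ _ ⟩
    x′ * ρa * ρb′
      ≡⟨ cong (λ m → x′ * ρa * r m) (ℕ.+-suc j d) ⟨
    ι (U (suc d)) * r j * r (j ℕ.+ suc d) ∎
    where
    open ≡-Reasoning
    a b b′ x x′ ρa ρb ρb′ : ℚ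
    a = ι (U (suc j))
    b = ι (U (suc (j ℕ.+ d)))
    b′ = ι (U (suc (suc (j ℕ.+ d))))
    x = ι (U d)
    x′ = ι (U (suc d))
    ρa = r j
    ρb = r (j ℕ.+ d)
    ρb′ = r (suc (j ℕ.+ d))
    casoratian′ : x′ * b - x * b′ ≡ a
    casoratian′ = trans (sym (ι-det _ _ _ _)) (cong ι (subst (λ m → U (suc d) ℤ.* U m ℤ.- U d ℤ.* U (suc m) ≡ U (suc j))
                        (trans (ℕ.+-suc d j) (cong suc (ℕ.+-comm d j))) (casoratian d (suc j))))
    algebra₁ : ∀ x ρa ρb ρb′ → x * ρa * ρb + ρb * ρb′ ≡ x * ρa * ρb * 1ℚ + 1ℚ * ρb * ρb′
    algebra₁ = solve-∀ ℚ-ring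
    algebra₂ : ∀ b b′ x x′ ρa ρb ρb′ →
      x * ρa * ρb * (b′ * ρb′) + (x′ * b - x * b′) * ρa * ρb * ρb′ ≡ x′ * ρa * ρb′ * (b * ρb)
    algebra₂ = solve-∀ ℚ-ring

  r-halving : ∀ j → r (suc j) + r (suc j) ≤ r j
  r-halving j = ≤-of-gap _ slack-nonneg gap
    where
    open ≡-Reasoning
    a b : ℚ
    a = ι (U (suc j))
    b = ι (U (suc (suc j)))
    slack-nonneg : 0ℚ ≤ (b - (a + a)) * r j * r (suc j)
    slack-nonneg = nonneg-* (nonneg-* b-2a-nonneg (r-nonneg j)) (r-nonneg (suc j))
      where
      b-2a-nonneg : 0ℚ ≤ b - (a + a)
      b-2a-nonneg = subst (0ℚ ≤_) (trans (ι-- _ _) (cong (λ t → b - t) (ι-+ _ _)))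
                          (ι-nonneg (ℤ.i≤j⇒0≤j-i (U-double (suc j))))
    gap : r j ≡ r (suc j) + r (suc j) + (b - (a + a)) * r j * r (suc j)
    gap = begin
      r j
        ≡⟨ algebra₁ (r j) (r (suc j)) ⟩
      r (suc j) + r (suc j) + (r j * 1ℚ - (1ℚ + 1ℚ) * r (suc j))
        ≡⟨ cong₂ (λ s t → r (suc j) + r (suc j) + (r j * s - (t + t) * r (suc j))) (sym (u*r≡1 (suc j))) (sym (u*r≡1 j)) ⟩
      r (suc j) + r (suc j) + (r j * (b * r (suc j)) - (a * r j + a * r j) * r (suc j))
        ≡⟨ algebra₂ a b (r j) (r (suc j)) ⟩
      r (suc j) + r (suc j) + (b - (a + a)) * r j * r (suc j) ∎
      where
      algebra₁ : ∀ x y → x ≡ y + y + (x * 1ℚ - (1ℚ + 1ℚ) * y)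
      algebra₁ = solve-∀ ℚ-ring
      algebra₂ : ∀ a b x y → y + y + (x * (b * y) - (a * x + a * x) * y) ≡ y + y + (b - (a + a)) * x * y
      algebra₂ = solve-∀ ℚ-ring

  ι-U-consecutive-products : ∀ k →
    ι (U (suc k)) * ι (U (suc (suc k))) + ι (U k) * ι (U (suc k))
      ≡ (1ℚ + 1ℚ + 1ℚ) * (ι (U k) * ι (U (suc (suc k)))) + (1ℚ + 1ℚ + 1ℚ)
  ι-U-consecutive-products k = begin
    ι (U (suc k)) * ι (U (suc (suc k))) + ι (U k) * ι (U (suc k))
      ≡⟨ cong₂ _+_ (ι-* _ _) (ι-* _ _) ⟨
    ι (U (suc k) ℤ.* U (suc (suc k))) + ι (U k ℤ.* U (suc k))
      ≡⟨ ι-+ _ _ ⟨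
    ι (U (suc k) ℤ.* U (suc (suc k)) ℤ.+ U k ℤ.* U (suc k))
      ≡⟨ cong ι (U-consecutive-products k) ⟩
    ι (+ 3 ℤ.* (U k ℤ.* U (suc (suc k))) ℤ.+ + 3)
      ≡⟨ ι-+ _ _ ⟩
    ι (+ 3 ℤ.* (U k ℤ.* U (suc (suc k)))) + ι (+ 3)
      ≡⟨ cong₂ _+_ (trans (ι-* _ _) (cong₂ _*_ ι-3 (ι-* _ _))) ι-3 ⟩
    (1ℚ + 1ℚ + 1ℚ) * (ι (U k) * ι (U (suc (suc k)))) + (1ℚ + 1ℚ + 1ℚ) ∎
    where open ≡-Reasoning

  r-strictly-convex : ∀ j → r (suc j) + r (suc j) + r (suc j) < r j + r (suc (suc j))
  r-strictly-convex j = <-of-gap (ρa * ρb * ρc + ρa * ρb * ρc + ρa * ρb * ρc) slack-pos (begin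
    ρa + ρc
      ≡⟨ algebra₁ ρa ρc ⟩
    ρa * 1ℚ * 1ℚ + ρc * 1ℚ * 1ℚ
      ≡⟨ cong₂ (λ s t → ρa * s * t + ρc * 1ℚ * 1ℚ) (sym (u*r≡1 (suc j))) (sym (u*r≡1 (suc (suc j)))) ⟩
    ρa * (b * ρb) * (c * ρc) + ρc * 1ℚ * 1ℚ
      ≡⟨ cong₂ (λ s t → ρa * (b * ρb) * (c * ρc) + ρc * s * t) (sym (u*r≡1 j)) (sym (u*r≡1 (suc j))) ⟩
    ρa * (b * ρb) * (c * ρc) + ρc * (a * ρa) * (b * ρb)
      ≡⟨ algebra₂ a b c ρa ρb ρc ⟩
    ρa * ρb * ρc * (b * c + a * b)
      ≡⟨ cong (ρa * ρb * ρc *_) (ι-U-consecutive-products (suc j)) ⟩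
    ρa * ρb * ρc * ((1ℚ + 1ℚ + 1ℚ) * (a * c) + (1ℚ + 1ℚ + 1ℚ))
      ≡⟨ algebra₃ a c ρa ρb ρc ⟩
    (ρb + ρb + ρb) * (a * ρa) * (c * ρc) + (ρa * ρb * ρc + ρa * ρb * ρc + ρa * ρb * ρc)
      ≡⟨ cong₂ (λ s t → (ρb + ρb + ρb) * s * t + (ρa * ρb * ρc + ρa * ρb * ρc + ρa * ρb * ρc))
               (u*r≡1 j) (u*r≡1 (suc (suc j))) ⟩
    (ρb + ρb + ρb) * 1ℚ * 1ℚ + (ρa * ρb * ρc + ρa * ρb * ρc + ρa * ρb * ρc)
      ≡⟨ algebra₄ ρb (ρa * ρb * ρc) ⟩
    ρb + ρb + ρb + (ρa * ρb * ρc + ρa * ρb * ρc + ρa * ρb * ρc)     ∎)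
    where
    open ≡-Reasoning
    a b c ρa ρb ρc : ℚ
    a = ι (U (suc j))
    b = ι (U (suc (suc j)))
    c = ι (U (suc (suc (suc j))))
    ρa = r j
    ρb = r (suc j)
    ρc = r (suc (suc j))
    slack-pos : 0ℚ < ρa * ρb * ρc + ρa * ρb * ρc + ρa * ρb * ρc
    slack-pos = pos-+ (pos-+ ρaρbρc-pos ρaρbρc-pos) ρaρbρc-pos
      where
      ρaρbρc-pos : 0ℚ < ρa * ρb * ρc
      ρaρbρc-pos = pos-* (pos-* (r-pos j) (r-pos (suc j))) (r-pos (suc (suc j)))
    algebra₁ : ∀ x y → x + y ≡ x * 1ℚ * 1ℚ + y * 1ℚ * 1ℚ
    algebra₁ = solve-∀ ℚ-ring
    algebra₂ : ∀ a b c ρa ρb ρc → ρa * (b * ρb) * (c * ρc) + ρc * (a * ρa) * (b * ρb) ≡ ρa * ρb * ρc * (b * c + a * b)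
    algebra₂ = solve-∀ ℚ-ring
    algebra₃ : ∀ a c ρa ρb ρc → ρa * ρb * ρc * ((1ℚ + 1ℚ + 1ℚ) * (a * c) + (1ℚ + 1ℚ + 1ℚ))
      ≡ (ρb + ρb + ρb) * (a * ρa) * (c * ρc) + (ρa * ρb * ρc + ρa * ρb * ρc + ρa * ρb * ρc)
    algebra₃ = solve-∀ ℚ-ring
    algebra₄ : ∀ x t → (x + x + x) * 1ℚ * 1ℚ + (t + t + t) ≡ x + x + x + (t + t + t)
    algebra₄ = solve-∀ ℚ-ring

  ι-U-sum-of-squares : ∀ j d →
    ι (U (suc (j ℕ.+ d))) * ι (U (suc (j ℕ.+ d))) + ι (U (suc j)) * ι (U (suc j))
      ≡ ι (B (U (suc (j ℕ.+ d))) (U (j ℕ.+ d)) (U (suc j)) (U j)) * ι (U (suc j)) * ι (U (suc (j ℕ.+ d)))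
        + ι (U d) * ι (U d)
  ι-U-sum-of-squares j d = begin
    ι x * ι x + ι y * ι y                      ≡⟨ cong₂ _+_ (ι-* x x) (ι-* y y) ⟨
    ι (x ℤ.* x) + ι (y ℤ.* y)                  ≡⟨ ι-+ _ _ ⟨
    ι (x ℤ.* x ℤ.+ y ℤ.* y)                    ≡⟨ cong ι (U-sum-of-squares j d) ⟩
    ι (b ℤ.* y ℤ.* x ℤ.+ U d ℤ.* U d)          ≡⟨ ι-+ _ _ ⟩
    ι (b ℤ.* y ℤ.* x) + ι (U d ℤ.* U d)        ≡⟨ cong₂ _+_ (trans (ι-* _ x) (cong (_* ι x) (ι-* b y))) (ι-* (U d) (U d)) ⟩
    ι b * ι y * ι x + ι (U d) * ι (U d)        ∎
    where
    open ≡-Reasoning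
    x y b : ℤ
    x = U (suc (j ℕ.+ d))
    y = U (suc j)
    b = B (U (suc (j ℕ.+ d))) (U (j ℕ.+ d)) (U (suc j)) (U j)

  pair-identity : ∀ j d →
    ι (U (suc (j ℕ.+ d))) * r j + ι (U (suc j)) * r (j ℕ.+ d)
      ≡ ι (B (U (suc (j ℕ.+ d))) (U (j ℕ.+ d)) (U (suc j)) (U j)) + ι (U d) * ι (U d) * r j * r (j ℕ.+ d)
  pair-identity j d = begin
    x * ρ + y * ρ′
      ≡⟨ algebra₁ x y ρ ρ′ ⟩
    x * ρ * 1ℚ + y * ρ′ * 1ℚ
      ≡⟨ cong₂ (λ s t → x * ρ * s + y * ρ′ * t) (sym (u*r≡1 (j ℕ.+ d))) (sym (u*r≡1 j)) ⟩
    x * ρ * (x * ρ′) + y * ρ′ * (y * ρ)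
      ≡⟨ algebra₂ x y ρ ρ′ ⟩
    (x * x + y * y) * (ρ * ρ′)
      ≡⟨ cong (_* (ρ * ρ′)) (ι-U-sum-of-squares j d) ⟩
    (L * y * x + D * D) * (ρ * ρ′)
      ≡⟨ algebra₃ x y L D ρ ρ′ ⟩
    L * (y * ρ) * (x * ρ′) + D * D * ρ * ρ′
      ≡⟨ cong₂ (λ s t → L * s * t + D * D * ρ * ρ′) (u*r≡1 j) (u*r≡1 (j ℕ.+ d)) ⟩
    L * 1ℚ * 1ℚ + D * D * ρ * ρ′
      ≡⟨ cong (_+ D * D * ρ * ρ′) (trans (*-identityʳ _) (*-identityʳ L)) ⟩
    L + D * D * ρ * ρ′ ∎
    where
    open ≡-Reasoning
    x y L D ρ ρ′ : ℚ
    x = ι (U (suc (j ℕ.+ d)))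
    y = ι (U (suc j))
    L = ι (B (U (suc (j ℕ.+ d))) (U (j ℕ.+ d)) (U (suc j)) (U j))
    D = ι (U d)
    ρ = r j
    ρ′ = r (j ℕ.+ d)
    algebra₁ : ∀ x y ρ ρ′ → x * ρ + y * ρ′ ≡ x * ρ * 1ℚ + y * ρ′ * 1ℚ
    algebra₁ = solve-∀ ℚ-ring
    algebra₂ : ∀ x y ρ ρ′ → x * ρ * (x * ρ′) + y * ρ′ * (y * ρ) ≡ (x * x + y * y) * (ρ * ρ′)
    algebra₂ = solve-∀ ℚ-ring
    algebra₃ : ∀ x y L D ρ ρ′ → (L * y * x + D * D) * (ρ * ρ′) ≡ L * (y * ρ) * (x * ρ′) + D * D * ρ * ρ′
    algebra₃ = solve-∀ ℚ-ring

module ReciprocalTail where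
  open import Data.Bool using (true; false; if_then_else_)
  open import Data.Integer as ℤ using (+_; 1ℤ)
  import Data.Integer.Properties as ℤ
  open import Data.Nat as ℕ using (ℕ; zero; suc)
  import Data.Nat.Properties as ℕ
  open import Data.Rational
  open import Data.Rational.Properties
  open import Relation.Binary.PropositionalEquality
  open import Tactic.RingSolver using (solve-∀)

  open DigitStrings
  open DigitBounds
  open DigitDifferences using (diff; diff-agree; diff-pos; diff-swap; diff-≤; BottomLead)
  open RationalEmbedding
  open Reciprocals

  ℚ-digits : DigitArithmetic
  ℚ-digits = record
    { A = ℚ ; 0# = 0ℚ ; _+_ = _+_ ; _·_ = λ n x → ι (+ n) * x ; _≤_ = _≤_ ; ≤-trans = ≤-trans
    ; +-monoˡ-≤ = +-monoˡ-≤ ; +-monoʳ-≤ = +-monoʳ-≤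
    ; +-identityˡ = +-identityˡ ; +-identityʳ = +-identityʳ
    ; 0·x≡0 = λ x → trans (cong (_* x) ι-0) (*-zeroˡ x)
    ; 1·x≡x = λ x → trans (cong (_* x) ι-1) (*-identityˡ x)
    ; 2·x≡x+x = λ x → trans (cong (_* x) (trans (ι-+ (+ 1) (+ 1)) (cong₂ _+_ ι-1 ι-1))) (two x) }
    where
    two : ∀ x → (1ℚ + 1ℚ) * x ≡ x + x
    two = solve-∀ ℚ-ring

  open DigitSums ℚ-digits

  private
    suffix-sum≡∑ : ∀ c k j → suffix-sum c (λ j _ → r j) j k ≡ ∑[ i < k ] (ι (+ c (j ℕ.+ i)) * r (j ℕ.+ i))
    suffix-sum≡∑ c zero    j = refl
    suffix-sum≡∑ c (suc k) j = begin
      ι (+ c j) * r j + suffix-sum c (λ j _ → r j) (suc j) k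
        ≡⟨ cong₂ _+_ (cong f (sym (ℕ.+-identityʳ j))) (suffix-sum≡∑ c k (suc j)) ⟩
      f (j ℕ.+ 0) + ∑[ i < k ] f (suc j ℕ.+ i)
        ≡⟨ cong (λ s → f (j ℕ.+ 0) + s) (∑-cong k λ i _ → cong f (sym (ℕ.+-suc j i))) ⟩
      f (j ℕ.+ 0) + ∑[ i < k ] f (j ℕ.+ suc i)
        ≡⟨ ∑-front k (λ i → f (j ℕ.+ i)) ⟨
      ∑[ i < suc k ] f (j ℕ.+ i) ∎
      where
      open ≡-Reasoning
      f : ℕ → ℚ
      f i = ι (+ c i) * r i

    halving-slack : ∀ j → 0ℚ ≤ r j - (r (suc j) + r (suc j))
    halving-slack j = p≤q⇒0≤q-p (r-halving j)

    convexity-slack : ∀ j → 0ℚ < r j + r (suc (suc j)) - (r (suc j) + r (suc j) + r (suc j))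
    convexity-slack j = p<q⇒0<q-p (r-strictly-convex j)

    -- Position 0 is never blocked, so tail-held 0 only has to satisfy the side conditions.
    tail-free : ℕ → ℚ
    tail-free j = r j + r j + (r j - r (suc j))

    tail-held : ℕ → ℚ
    tail-held zero    = tail-free zero
    tail-held (suc j) = r j - r (suc j)

    r-step-nonneg : ∀ j → 0ℚ ≤ r j - r (suc j)
    r-step-nonneg j = ≤-of-gap _ (nonneg-+ (halving-slack j) (r-nonneg (suc j))) (algebra (r j) (r (suc j)))
      where
      algebra : ∀ x y → x - y ≡ 0ℚ + ((x - (y + y)) + y)
      algebra = solve-∀ ℚ-ring

    tail-free-nonneg : ∀ j → 0ℚ ≤ tail-free j
    tail-free-nonneg j = nonneg-+ (nonneg-+ (r-nonneg j) (r-nonneg j)) (r-step-nonneg j)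

    tail-held-nonneg : ∀ j → 0ℚ ≤ tail-held j
    tail-held-nonneg zero    = tail-free-nonneg zero
    tail-held-nonneg (suc j) = r-step-nonneg j

    tail-free-0 : ∀ j → tail-free (suc j) ≤ tail-free j
    tail-free-0 j = ≤-of-gap _
      (nonneg-+ (nonneg-+ (nonneg-+ (nonneg-+ (halving-slack j) (halving-slack j)) (halving-slack j))
                          (nonneg-+ (r-nonneg (suc j)) (r-nonneg (suc j)))) (r-nonneg (suc (suc j))))
      (algebra (r j) (r (suc j)) (r (suc (suc j))))
      where
      algebra : ∀ x y z → x + x + (x - y) ≡ y + y + (y - z) + ((x - (y + y)) + (x - (y + y)) + (x - (y + y)) + (y + y) + z)
      algebra = solve-∀ ℚ-ring

    tail-held-0 : ∀ j → tail-free (suc j) ≤ tail-held j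
    tail-held-0 zero    = tail-free-0 zero
    tail-held-0 (suc j) = ≤-of-gap _
      (nonneg-+ (nonneg-+ (nonneg-+ (halving-slack (suc j)) (halving-slack (suc j))) (<⇒≤ (convexity-slack j)))
                (r-nonneg (suc (suc (suc j)))))
      (algebra (r j) (r (suc j)) (r (suc (suc j))) (r (suc (suc (suc j)))))
      where
      algebra : ∀ w x y z → w - x ≡ y + y + (y - z) + ((x - (y + y)) + (x - (y + y)) + (w + y - (x + x + x)) + z)
      algebra = solve-∀ ℚ-ring

    tail-free-1 : ∀ j → r j + tail-free (suc j) ≤ tail-free j
    tail-free-1 j = ≤-of-gap _ (nonneg-+ (nonneg-+ (halving-slack j) (halving-slack j)) (r-nonneg (suc (suc j))))
                              (algebra (r j) (r (suc j)) (r (suc (suc j))))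
      where
      algebra : ∀ x y z → x + x + (x - y) ≡ x + (y + y + (y - z)) + ((x - (y + y)) + (x - (y + y)) + z)
      algebra = solve-∀ ℚ-ring

    tail-held-1 : ∀ j → r j + tail-held (suc j) ≤ tail-held j
    tail-held-1 zero    = ≤-of-gap _ (r-nonneg 0) (algebra (r 0) (r 1))
      where
      algebra : ∀ x y → x + x + (x - y) ≡ x + (x - y) + x
      algebra = solve-∀ ℚ-ring
    tail-held-1 (suc j) = ≤-of-gap _ (<⇒≤ (convexity-slack j)) (algebra (r j) (r (suc j)) (r (suc (suc j))))
      where
      algebra : ∀ x y z → x - y ≡ y + (y - z) + (x + z - (y + y + y))
      algebra = solve-∀ ℚ-ring

    tail-bounds : SuffixBounds (λ j _ → r j)
    tail-bounds = record
      { free       = λ j _ → tail-free j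
      ; held       = λ j _ → tail-held j
      ; free-start = tail-free-nonneg
      ; held-start = tail-held-nonneg
      ; free-0     = λ j _ → tail-free-0 j
      ; held-0     = λ j _ → tail-held-0 j
      ; free-1     = λ j _ → tail-free-1 j
      ; held-1     = λ j _ → tail-held-1 j
      ; free-2     = λ _ _ → ≤-refl
      }

    tail-below : ∀ m b → (if b then tail-held (suc m) else tail-free (suc m)) < r m
    tail-below m true  = <-of-gap _ (r-pos (suc m)) (algebra (r m) (r (suc m)))
      where
      algebra : ∀ x y → x ≡ x - y + y
      algebra = solve-∀ ℚ-ring
    tail-below m false = <-of-gap _ (convexity-slack m) (algebra (r m) (r (suc m)) (r (suc (suc m))))
      where
      algebra : ∀ x y z → x ≡ y + y + (y - z) + (x + z - (y + y + y))
      algebra = solve-∀ ℚ-ring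

  reciprocal-tail : ∀ {c} → Valid c → ∀ m k → ∑[ i < k ] (ι (+ c (suc m ℕ.+ i)) * r (suc m ℕ.+ i)) < r m
  reciprocal-tail {c} valid m k = subst (_< r m) (suffix-sum≡∑ c k (suc m))
    (≤-<-trans (suffix-bound valid tail-bounds k (suc m)) (tail-below m (blocked c (suc m))))

  reciprocal-sum-neg : ∀ {c c′} → Valid c → (bl : BottomLead c′ c) →
    ∀ n → BottomLead.position bl ℕ.< n → ∑[ j < n ] (ι (diff c c′ j) * r j) < 0ℚ
  reciprocal-sum-neg {c} {c′} valid bl n m<n = begin-strict
    ∑ n f                                            ≡⟨ cong (λ l → ∑ l f) (trans (ℕ.+-suc m k) (ℕ.m+[n∸m]≡n m<n)) ⟨
    ∑ (m ℕ.+ suc k) f                                ≡⟨ ∑-split m (suc k) f ⟩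
    ∑ m f + ∑[ i < suc k ] f (m ℕ.+ i)               ≡⟨ cong₂ _+_ (∑-zero m agreeing) (∑-front k (λ i → f (m ℕ.+ i))) ⟩
    0ℚ + (f (m ℕ.+ 0) + ∑[ i < k ] f (m ℕ.+ suc i))  ≡⟨ +-identityˡ _ ⟩
    f (m ℕ.+ 0) + ∑[ i < k ] f (m ℕ.+ suc i)         <⟨ +-mono-≤-< lowest-term tail-bound ⟩
    - r m + r m                                      ≡⟨ +-inverseˡ (r m) ⟩
    0ℚ ∎
    where
    open ≤-Reasoning
    open BottomLead bl renaming (position to m)
    k : ℕ
    k = n ℕ.∸ suc m
    f : ℕ → ℚ
    f j = ι (diff c c′ j) * r j
    agreeing : ∀ i → i ℕ.< m → f i ≡ 0ℚ
    agreeing i i<m = trans (cong (λ x → ι x * r i) (diff-agree (sym (agree-below i i<m))))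
                           (trans (cong (_* r i) ι-0) (*-zeroˡ (r i)))
    lowest-term : f (m ℕ.+ 0) ≤ - r m
    lowest-term = begin
      f (m ℕ.+ 0)              ≡⟨ cong f (ℕ.+-identityʳ m) ⟩
      ι (diff c c′ m) * r m    ≤⟨ *-monoʳ-≤-nonNeg (r m) {{nonNegative (r-nonneg m)}} (ι-mono-≤ diff≤-1) ⟩
      ι (ℤ.- 1ℤ) * r m         ≡⟨ cong (_* r m) (trans (ι-neg 1ℤ) (cong -_ ι-1)) ⟩
      - 1ℚ * r m               ≡⟨ algebra (r m) ⟩
      - r m ∎
      where
      diff≤-1 : diff c c′ m ℤ.≤ ℤ.- 1ℤ
      diff≤-1 = subst (ℤ._≤ ℤ.- 1ℤ) (sym (diff-swap c′ c m)) (ℤ.neg-mono-≤ (diff-pos lead))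
      algebra : ∀ x → - 1ℚ * x ≡ - x
      algebra = solve-∀ ℚ-ring
    tail-bound : ∑[ i < k ] f (m ℕ.+ suc i) < r m
    tail-bound = ≤-<-trans
      (∑-mono-≤ k λ i _ → subst (λ l → f (m ℕ.+ suc i) ≤ ι (+ c l) * r l) (ℕ.+-suc m i) (digit-dominates (m ℕ.+ suc i)))
                           (reciprocal-tail valid m k)
      where
      digit-dominates : ∀ l → f l ≤ ι (+ c l) * r l
      digit-dominates l = *-monoʳ-≤-nonNeg (r l) {{nonNegative (r-nonneg l)}} (ι-mono-≤ (diff-≤ c c′ l))

module WeightedSums (e : ℕ → ℤ) where
  open import Data.Integer using (ℤ; +_; 0ℤ; 1ℤ; _+_; _*_; _-_; -_; _≤_)
  open import Data.Nat as ℕ using (ℕ; zero; suc; _∸_; _<_)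
  open import Data.Integer.Properties
  open import Data.Integer.Tactic.RingSolver using (solve-∀)
  import Data.Nat.Properties as ℕ
  open import Relation.Binary.PropositionalEquality
  open ≡-Reasoning

  open RangeSum +-*-commutativeRing
  open EvenFibonacci

  V : ℕ → ℤ
  V n = ∑[ j < n ] (e j * U (suc j))

  P : ℕ → ℤ
  P n = ∑[ j < n ] (e j * U j)

  N : ℕ → ℤ
  N n = Q (V n) (P n)

  pairing : ℕ → ℤ
  pairing n = B (U (suc n)) (U n) (V n) (P n)

  N-step : ∀ n → N (suc n) ≡ N n + e n * e n + e n * pairing n
  N-step n = begin
    N (suc n)
      ≡⟨ algebra (V n) (P n) (e n) (U (suc n)) (U n) ⟩
    N n + e n * e n * Q (U (suc n)) (U n) + e n * pairing n
      ≡⟨ cong (λ q → N n + e n * e n * q + e n * pairing n) (cassini n) ⟩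
    N n + e n * e n * 1ℤ + e n * pairing n
      ≡⟨ cong (λ x → N n + x + e n * pairing n) (*-identityʳ (e n * e n)) ⟩
    N n + e n * e n + e n * pairing n ∎
    where
    algebra : ∀ v p t a b →
      (v + t * a) * (v + t * a) - + 3 * (v + t * a) * (p + t * b) + (p + t * b) * (p + t * b)
        ≡ (v * v - + 3 * v * p + p * p) + t * t * (a * a - + 3 * a * b + b * b)
          + t * (+ 2 * a * v - + 3 * (a * p + v * b) + + 2 * b * p)
    algebra = solve-∀

  pairing-linear : ∀ n → pairing n ≡ ∑[ j < n ] (e j * B (U (suc n)) (U n) (U (suc j)) (U j))
  pairing-linear n = begin
    pairing n
      ≡⟨ algebra₁ x y (V n) (P n) ⟩
    α * V n + β * P n
      ≡⟨ cong₂ _+_ (*-distribˡ-∑ n α _) (*-distribˡ-∑ n β _) ⟩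
    ∑[ j < n ] (α * (e j * U (suc j))) + ∑[ j < n ] (β * (e j * U j))
      ≡⟨ ∑-distrib-+ n _ _ ⟨
    ∑[ j < n ] (α * (e j * U (suc j)) + β * (e j * U j))
      ≡⟨ ∑-cong n (λ j _ → algebra₂ x y (e j) (U (suc j)) (U j)) ⟩
    ∑[ j < n ] (e j * B x y (U (suc j)) (U j)) ∎
    where
    x y α β : ℤ
    x = U (suc n)
    y = U n
    α = + 2 * x - + 3 * y
    β = + 2 * y - + 3 * x
    algebra₁ : ∀ x y v p → + 2 * x * v - + 3 * (x * p + v * y) + + 2 * y * p ≡ (+ 2 * x - + 3 * y) * v + (+ 2 * y - + 3 * x) * p
    algebra₁ = solve-∀
    algebra₂ : ∀ x y t a b → (+ 2 * x - + 3 * y) * (t * a) + (+ 2 * y - + 3 * x) * (t * b)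
                           ≡ t * (+ 2 * x * a - + 3 * (x * b + a * y) + + 2 * y * b)
    algebra₂ = solve-∀

  upper : (ℕ → ℤ) → ℕ → ℕ → ℤ
  upper ω n κ = ∑[ i < n ∸ κ ] (e (κ ℕ.+ i) * ω i)

  lower : (ℕ → ℤ) → ℕ → ℤ
  lower Ω κ = ∑[ j < κ ] (e j * Ω (κ ∸ suc j))

  -- By U-addition, G n κ = Σ_{i < κ ≤ j < n} e i · e j · U (j - i).
  G : ℕ → ℕ → ℤ
  G n κ = upper (λ i → U (suc i)) n κ * lower (λ k → U (suc k)) κ - upper U n κ * lower U κ

  cross : ℕ → ℕ → ℤ
  cross n κ = ∑[ j < κ ] (e j * U (n ∸ j))

  upper-step : ∀ ω {n κ} → κ ℕ.≤ n → upper ω (suc n) κ ≡ upper ω n κ + e n * ω (n ∸ κ)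
  upper-step ω {n} {κ} κ≤n rewrite ℕ.+-∸-assoc 1 κ≤n =
    cong (λ m → upper ω n κ + e m * ω (n ∸ κ)) (ℕ.m+[n∸m]≡n κ≤n)

  upper-top : ∀ ω n → upper ω n n ≡ 0ℤ
  upper-top ω n rewrite ℕ.n∸n≡0 n = refl

  cross-factorises : ∀ {n κ} → κ ℕ.≤ n →
    U (suc (n ∸ κ)) * lower (λ k → U (suc k)) κ - U (n ∸ κ) * lower U κ ≡ cross n κ
  cross-factorises {n} {κ} κ≤n = begin
    x′ * lower (λ k → U (suc k)) κ - x * lower U κ
      ≡⟨ cong₂ _-_ (*-distribˡ-∑ κ x′ _) (*-distribˡ-∑ κ x _) ⟩
    ∑[ j < κ ] (x′ * (e j * U (suc (κ ∸ suc j)))) - ∑[ j < κ ] (x * (e j * U (κ ∸ suc j)))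
      ≡⟨ ∑-distrib-sub κ _ _ ⟨
    ∑[ j < κ ] (x′ * (e j * U (suc (κ ∸ suc j))) - x * (e j * U (κ ∸ suc j)))
      ≡⟨ ∑-cong κ term ⟩
    cross n κ ∎
    where
    x x′ : ℤ
    x = U (n ∸ κ)
    x′ = U (suc (n ∸ κ))
    algebra : ∀ a′ a t b′ b → a′ * (t * b′) - a * (t * b) ≡ t * (a′ * b′ - a * b)
    algebra = solve-∀
    index : ∀ {j} → j < κ → suc ((n ∸ κ) ℕ.+ (κ ∸ suc j)) ≡ n ∸ j
    index {j} j<κ = begin
      suc ((n ∸ κ) ℕ.+ (κ ∸ suc j))   ≡⟨ ℕ.+-suc (n ∸ κ) (κ ∸ suc j) ⟨
      (n ∸ κ) ℕ.+ suc (κ ∸ suc j)     ≡⟨ cong ((n ∸ κ) ℕ.+_) (ℕ.+-∸-assoc 1 j<κ) ⟨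
      (n ∸ κ) ℕ.+ (κ ∸ j)             ≡⟨ ℕ.+-∸-assoc (n ∸ κ) (ℕ.<⇒≤ j<κ) ⟨
      (n ∸ κ) ℕ.+ κ ∸ j               ≡⟨ cong (_∸ j) (ℕ.m∸n+n≡m κ≤n) ⟩
      n ∸ j ∎
    term : ∀ j → j < κ → x′ * (e j * U (suc (κ ∸ suc j))) - x * (e j * U (κ ∸ suc j)) ≡ e j * U (n ∸ j)
    term j j<κ = begin
      x′ * (e j * U (suc (κ ∸ suc j))) - x * (e j * U (κ ∸ suc j)) ≡⟨ algebra x′ x (e j) _ _ ⟩
      e j * (x′ * U (suc (κ ∸ suc j)) - x * U (κ ∸ suc j))        ≡⟨ cong (e j *_) (U-addition (n ∸ κ) (κ ∸ suc j)) ⟨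
      e j * U (suc ((n ∸ κ) ℕ.+ (κ ∸ suc j)))                     ≡⟨ cong (λ m → e j * U m) (index j<κ) ⟩
      e j * U (n ∸ j) ∎

  G-step : ∀ {n κ} → κ ℕ.≤ n → G (suc n) κ ≡ G n κ + e n * cross n κ
  G-step {n} {κ} κ≤n = begin
    G (suc n) κ
      ≡⟨ cong₂ (λ a b → a * l′ - b * l) (upper-step (λ i → U (suc i)) κ≤n) (upper-step U κ≤n) ⟩
    (u′ + e n * U (suc (n ∸ κ))) * l′ - (u + e n * U (n ∸ κ)) * l
      ≡⟨ algebra u′ u (e n) (U (suc (n ∸ κ))) (U (n ∸ κ)) l′ l ⟩
    G n κ + e n * (U (suc (n ∸ κ)) * l′ - U (n ∸ κ) * l)
      ≡⟨ cong (λ z → G n κ + e n * z) (cross-factorises κ≤n) ⟩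
    G n κ + e n * cross n κ ∎
    where
    u′ u l′ l : ℤ
    u′ = upper (λ i → U (suc i)) n κ
    u = upper U n κ
    l′ = lower (λ k → U (suc k)) κ
    l = lower U κ
    algebra : ∀ u′ u t x′ x l′ l → (u′ + t * x′) * l′ - (u + t * x) * l ≡ (u′ * l′ - u * l) + t * (x′ * l′ - x * l)
    algebra = solve-∀

  G-top : ∀ n → G n n ≡ 0ℤ
  G-top n rewrite upper-top (λ i → U (suc i)) n | upper-top U n = algebra (lower (λ k → U (suc k)) n) (lower U n)
    where
    algebra : ∀ a b → 0ℤ * a - 0ℤ * b ≡ 0ℤ
    algebra = solve-∀

  private
    difference-Δ : ∀ x i → x * U (suc i) - x * U i ≡ x * Δ i
    difference-Δ x i = trans (cong (λ u → x * u - x * U i) (U-suc i)) (algebra x (U i) (Δ i))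
      where
      algebra : ∀ x u d → x * (u + d) - x * u ≡ x * d
      algebra = solve-∀

  upper-Δ : ∀ n κ → upper (λ i → U (suc i)) n κ - upper U n κ ≡ upper Δ n κ
  upper-Δ n κ = trans (sym (∑-distrib-sub (n ∸ κ) _ _)) (∑-cong (n ∸ κ) λ i _ → difference-Δ (e (κ ℕ.+ i)) i)

  lower-Δ : ∀ κ → lower (λ k → U (suc k)) κ - lower U κ ≡ lower Δ κ
  lower-Δ κ = trans (sym (∑-distrib-sub κ _ _)) (∑-cong κ λ j _ → difference-Δ (e j) (κ ∸ suc j))

  G-split : ∀ n κ → G n κ ≡ upper Δ n κ * lower (λ k → U (suc k)) κ + upper U n κ * lower Δ κ
  G-split n κ = begin
    u′ * l′ - u * l                     ≡⟨ algebra u′ u l′ l ⟩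
    (u′ - u) * l′ + u * (l′ - l)        ≡⟨ cong₂ (λ a b → a * l′ + u * b) (upper-Δ n κ) (lower-Δ κ) ⟩
    upper Δ n κ * l′ + u * lower Δ κ ∎
    where
    u′ u l′ l : ℤ
    u′ = upper (λ i → U (suc i)) n κ
    u = upper U n κ
    l′ = lower (λ k → U (suc k)) κ
    l = lower U κ
    algebra : ∀ u′ u l′ l → u′ * l′ - u * l ≡ (u′ - u) * l′ + u * (l′ - l)
    algebra = solve-∀

  A : ℕ → ℤ
  A n = lower (λ k → U (suc k)) n

  A-via-V-P : ∀ n → V n * U n - P n * U (suc n) ≡ A n
  A-via-V-P n = begin
    V n * U n - P n * U (suc n)
      ≡⟨ cong₂ _-_ (*-distribʳ-∑ n (U n) _) (*-distribʳ-∑ n (U (suc n)) _) ⟩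
    ∑[ j < n ] (e j * U (suc j) * U n) - ∑[ j < n ] (e j * U j * U (suc n))
      ≡⟨ ∑-distrib-sub n _ _ ⟨
    ∑[ j < n ] (e j * U (suc j) * U n - e j * U j * U (suc n))
      ≡⟨ ∑-cong n term ⟩
    A n ∎
    where
    algebra : ∀ t a b c d → t * a * b - t * c * d ≡ t * (a * b - c * d)
    algebra = solve-∀
    term : ∀ j → j < n → e j * U (suc j) * U n - e j * U j * U (suc n) ≡ e j * U (suc (n ∸ suc j))
    term j j<n = begin
      e j * U (suc j) * U n - e j * U j * U (suc n)
        ≡⟨ algebra (e j) _ _ _ _ ⟩
      e j * (U (suc j) * U n - U j * U (suc n))
        ≡⟨ cong (λ m → e j * (U (suc j) * U m - U j * U (suc m))) (ℕ.m+[n∸m]≡n (ℕ.<⇒≤ j<n)) ⟨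
      e j * (U (suc j) * U (j ℕ.+ (n ∸ j)) - U j * U (suc (j ℕ.+ (n ∸ j))))
        ≡⟨ cong (e j *_) (casoratian j (n ∸ j)) ⟩
      e j * U (n ∸ j)
        ≡⟨ cong (λ m → e j * U m) (ℕ.+-∸-assoc 1 j<n) ⟩
      e j * U (suc (n ∸ suc j)) ∎

  norm-identity : ∀ n → N n * (U (suc n) * U (suc n))
    ≡ V n * V n + (+ 3 * U (suc n) - + 2 * U n) * A n * V n + A n * A n
  norm-identity n = begin
    N n * (u * u)
      ≡⟨ algebra₁ (N n) (V n) u ⟩
    N n * (u * u) + V n * V n * (1ℤ - 1ℤ)
      ≡⟨ cong (λ q → N n * (u * u) + V n * V n * (1ℤ - q)) (cassini n) ⟨
    N n * (u * u) + V n * V n * (1ℤ - Q u u′)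
      ≡⟨ algebra₂ (V n) (P n) u u′ ⟩
    V n * V n + (+ 3 * u - + 2 * u′) * (V n * u′ - P n * u) * V n + (V n * u′ - P n * u) * (V n * u′ - P n * u)
      ≡⟨ cong (λ a → V n * V n + (+ 3 * u - + 2 * u′) * a * V n + a * a) (A-via-V-P n) ⟩
    V n * V n + (+ 3 * u - + 2 * u′) * A n * V n + A n * A n ∎
    where
    u u′ : ℤ
    u = U (suc n)
    u′ = U n
    algebra₁ : ∀ x v u → x * (u * u) ≡ x * (u * u) + v * v * (1ℤ - 1ℤ)
    algebra₁ = solve-∀
    algebra₂ : ∀ v p u u′ →
      (v * v - + 3 * v * p + p * p) * (u * u) + v * v * (1ℤ - (u * u - + 3 * u * u′ + u′ * u′))
        ≡ v * v + (+ 3 * u - + 2 * u′) * (v * u′ - p * u) * v + (v * u′ - p * u) * (v * u′ - p * u)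
    algebra₂ = solve-∀

module KeyIdentity (e : ℕ → ℤ) where
  open import Data.Integer as ℤ using (ℤ; 0ℤ; 1ℤ)
  open import Data.Nat as ℕ using (ℕ; zero; suc; _∸_)
  import Data.Nat.Properties as ℕ
  open import Data.Rational
  open import Data.Rational.Properties
  open import Relation.Binary.PropositionalEquality
  open import Tactic.RingSolver using (solve-∀)

  open EvenFibonacci
  open RationalEmbedding
  open Reciprocals
  open WeightedSums e

  D : ℕ → ℚ
  D n = ∑[ j < n ] (ι (e j) * r j)

  S : ℕ → ℚ
  S n = ∑[ t < n ] (ι (cross n (suc t)) * w t)

  C : ℕ → ℚ
  C n = ∑[ t < n ] (ι (G n (suc t)) * w t)

  S-closed-form : ∀ n → S n ≡ ∑[ j < n ] (ι (e j) * (ι (U (n ∸ j)) * ι (U (n ∸ j)) * r j * r n))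
  S-closed-form n = begin
    S n
      ≡⟨ ∑-cong n (λ t _ → cong (_* w t) (ι-∑ (suc t) _)) ⟩
    ∑[ t < n ] (∑ (suc t) f * w t)
      ≡⟨ ∑-triangle n f w ⟩
    ∑[ j < n ] (f j * ∑[ t < n ∸ j ] w (j ℕ.+ t))
      ≡⟨ ∑-cong n term ⟩
    ∑[ j < n ] (ι (e j) * (ι (U (n ∸ j)) * ι (U (n ∸ j)) * r j * r n)) ∎
    where
    open ≡-Reasoning
    f : ℕ → ℚ
    f j = ι (e j ℤ.* U (n ∸ j))
    algebra : ∀ x a ρ ρ′ → x * a * (a * ρ * ρ′) ≡ x * (a * a * ρ * ρ′)
    algebra = solve-∀ ℚ-ring
    term : ∀ j → j ℕ.< n → f j * ∑[ t < n ∸ j ] w (j ℕ.+ t) ≡ ι (e j) * (ι (U (n ∸ j)) * ι (U (n ∸ j)) * r j * r n)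
    term j j<n = begin
      f j * ∑[ t < n ∸ j ] w (j ℕ.+ t)
        ≡⟨ cong₂ _*_ (ι-* (e j) (U (n ∸ j))) (telescoping j (n ∸ j)) ⟩
      ι (e j) * ι (U (n ∸ j)) * (ι (U (n ∸ j)) * r j * r (j ℕ.+ (n ∸ j)))
        ≡⟨ cong (λ m → ι (e j) * ι (U (n ∸ j)) * (ι (U (n ∸ j)) * r j * r m)) (ℕ.m+[n∸m]≡n (ℕ.<⇒≤ j<n)) ⟩
      ι (e j) * ι (U (n ∸ j)) * (ι (U (n ∸ j)) * r j * r n)
        ≡⟨ algebra (ι (e j)) (ι (U (n ∸ j))) (r j) (r n) ⟩
      ι (e j) * (ι (U (n ∸ j)) * ι (U (n ∸ j)) * r j * r n) ∎

  linear-part : ∀ n → ι (U (suc n)) * D n + ι (V n) * r n ≡ ι (pairing n) + S n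
  linear-part n = begin
    ι (U (suc n)) * D n + ι (V n) * r n
      ≡⟨ cong₂ _+_ (*-distribˡ-∑ n (ι (U (suc n))) _) (trans (cong (_* r n) (ι-∑ n _)) (*-distribʳ-∑ n (r n) _)) ⟩
    ∑[ j < n ] (ι (U (suc n)) * (ι (e j) * r j)) + ∑[ j < n ] (ι (e j ℤ.* U (suc j)) * r n)
      ≡⟨ ∑-distrib-+ n _ _ ⟨
    ∑[ j < n ] (ι (U (suc n)) * (ι (e j) * r j) + ι (e j ℤ.* U (suc j)) * r n)
      ≡⟨ ∑-cong n term ⟩
    ∑[ j < n ] (ι (e j ℤ.* b j) + ι (e j) * (ι (U (n ∸ j)) * ι (U (n ∸ j)) * r j * r n))
      ≡⟨ ∑-distrib-+ n _ _ ⟩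
    ∑[ j < n ] ι (e j ℤ.* b j) + ∑[ j < n ] (ι (e j) * (ι (U (n ∸ j)) * ι (U (n ∸ j)) * r j * r n))
      ≡⟨ cong₂ _+_ (trans (sym (ι-∑ n _)) (cong ι (sym (pairing-linear n)))) (sym (S-closed-form n)) ⟩
    ι (pairing n) + S n ∎
    where
    open ≡-Reasoning
    b : ℕ → ℤ
    b j = B (U (suc n)) (U n) (U (suc j)) (U j)
    algebra : ∀ x y t ρ ρ′ → x * (t * ρ) + t * y * ρ′ ≡ t * (x * ρ + y * ρ′)
    algebra = solve-∀ ℚ-ring
    term : ∀ j → j ℕ.< n → ι (U (suc n)) * (ι (e j) * r j) + ι (e j ℤ.* U (suc j)) * r n
                         ≡ ι (e j ℤ.* b j) + ι (e j) * (ι (U (n ∸ j)) * ι (U (n ∸ j)) * r j * r n)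
    term j j<n = begin
      ι (U (suc n)) * (ι (e j) * r j) + ι (e j ℤ.* U (suc j)) * r n
        ≡⟨ cong (λ x → ι (U (suc n)) * (ι (e j) * r j) + x * r n) (ι-* (e j) (U (suc j))) ⟩
      ι (U (suc n)) * (ι (e j) * r j) + ι (e j) * ι (U (suc j)) * r n
        ≡⟨ algebra (ι (U (suc n))) (ι (U (suc j))) (ι (e j)) (r j) (r n) ⟩
      ι (e j) * (ι (U (suc n)) * r j + ι (U (suc j)) * r n)
        ≡⟨ cong (ι (e j) *_) pair ⟩
      ι (e j) * (ι (b j) + ι (U (n ∸ j)) * ι (U (n ∸ j)) * r j * r n)
        ≡⟨ *-distribˡ-+ (ι (e j)) _ _ ⟩
      ι (e j) * ι (b j) + ι (e j) * (ι (U (n ∸ j)) * ι (U (n ∸ j)) * r j * r n)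
        ≡⟨ cong (_+ ι (e j) * (ι (U (n ∸ j)) * ι (U (n ∸ j)) * r j * r n)) (ι-* (e j) (b j)) ⟨
      ι (e j ℤ.* b j) + ι (e j) * (ι (U (n ∸ j)) * ι (U (n ∸ j)) * r j * r n) ∎
      where
      pair : ι (U (suc n)) * r j + ι (U (suc j)) * r n ≡ ι (b j) + ι (U (n ∸ j)) * ι (U (n ∸ j)) * r j * r n
      pair = subst (λ m → ι (U (suc m)) * r j + ι (U (suc j)) * r m
                        ≡ ι (B (U (suc m)) (U m) (U (suc j)) (U j)) + ι (U (n ∸ j)) * ι (U (n ∸ j)) * r j * r m)
                   (ℕ.m+[n∸m]≡n (ℕ.<⇒≤ j<n)) (pair-identity j (n ∸ j))

  C-step : ∀ n → C (suc n) ≡ C n + ι (e n) * S n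
  C-step n = begin
    ∑[ t < n ] (ι (G (suc n) (suc t)) * w t) + ι (G (suc n) (suc n)) * w n
      ≡⟨ cong₂ _+_ (∑-cong n term)
                   (trans (cong (λ g → ι g * w n) (G-top (suc n))) (trans (cong (_* w n) ι-0) (*-zeroˡ (w n)))) ⟩
    ∑[ t < n ] (ι (G n (suc t)) * w t + ι (e n) * (ι (cross n (suc t)) * w t)) + 0ℚ
      ≡⟨ +-identityʳ _ ⟩
    ∑[ t < n ] (ι (G n (suc t)) * w t + ι (e n) * (ι (cross n (suc t)) * w t))
      ≡⟨ ∑-distrib-+ n _ _ ⟩
    C n + ∑[ t < n ] (ι (e n) * (ι (cross n (suc t)) * w t))
      ≡⟨ cong (C n +_) (*-distribˡ-∑ n (ι (e n)) _) ⟨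
    C n + ι (e n) * S n ∎
    where
    open ≡-Reasoning
    algebra : ∀ g x a w → (g + x * a) * w ≡ g * w + x * (a * w)
    algebra = solve-∀ ℚ-ring
    term : ∀ t → t ℕ.< n → ι (G (suc n) (suc t)) * w t ≡ ι (G n (suc t)) * w t + ι (e n) * (ι (cross n (suc t)) * w t)
    term t t<n = begin
      ι (G (suc n) (suc t)) * w t
        ≡⟨ cong (λ g → ι g * w t) (G-step t<n) ⟩
      ι (G n (suc t) ℤ.+ e n ℤ.* cross n (suc t)) * w t
        ≡⟨ cong (_* w t) (trans (ι-+ _ _) (cong (ι (G n (suc t)) +_) (ι-* _ _))) ⟩
      (ι (G n (suc t)) + ι (e n) * ι (cross n (suc t))) * w t
        ≡⟨ algebra (ι (G n (suc t))) (ι (e n)) (ι (cross n (suc t))) (w t) ⟩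
      ι (G n (suc t)) * w t + ι (e n) * (ι (cross n (suc t)) * w t) ∎

  main-identity : ∀ n → ι (V n) * D n ≡ ι (N n) + C n
  main-identity zero    = trans (*-zeroʳ (ι ℤ.0ℤ)) (sym (trans (cong (_+ 0ℚ) ι-0) (+-identityʳ 0ℚ)))
  main-identity (suc n) = begin
    ι (V n ℤ.+ e n ℤ.* U (suc n)) * (D n + ι (e n) * r n)
      ≡⟨ cong (_* (D n + ι (e n) * r n)) (trans (ι-+ _ _) (cong (ι (V n) +_) (ι-* _ _))) ⟩
    (ι (V n) + t * u) * (D n + t * r n)
      ≡⟨ algebra₁ (ι (V n)) (D n) t u (r n) ⟩
    ι (V n) * D n + t * (u * D n + ι (V n) * r n) + t * t * (u * r n)
      ≡⟨ cong₂ (λ x y → x + t * y + t * t * (u * r n)) (main-identity n) (linear-part n) ⟩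
    ι (N n) + C n + t * (ι (pairing n) + S n) + t * t * (u * r n)
      ≡⟨ cong (λ x → ι (N n) + C n + t * (ι (pairing n) + S n) + t * t * x) (u*r≡1 n) ⟩
    ι (N n) + C n + t * (ι (pairing n) + S n) + t * t * 1ℚ
      ≡⟨ algebra₂ (ι (N n)) (C n) t (ι (pairing n)) (S n) ⟩
    ι (N n) + t * t + t * ι (pairing n) + (C n + t * S n)
      ≡⟨ cong₂ _+_ (sym ι-N-step) (sym (C-step n)) ⟩
    ι (N (suc n)) + C (suc n) ∎
    where
    open ≡-Reasoning
    t u : ℚ
    t = ι (e n)
    u = ι (U (suc n))
    algebra₁ : ∀ v d t u ρ → (v + t * u) * (d + t * ρ) ≡ v * d + t * (u * d + v * ρ) + t * t * (u * ρ)
    algebra₁ = solve-∀ ℚ-ring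
    algebra₂ : ∀ x c t p s → x + c + t * (p + s) + t * t * 1ℚ ≡ x + t * t + t * p + (c + t * s)
    algebra₂ = solve-∀ ℚ-ring
    ι-N-step : ι (N (suc n)) ≡ ι (N n) + t * t + t * ι (pairing n)
    ι-N-step = begin
      ι (N (suc n))
        ≡⟨ cong ι (N-step n) ⟩
      ι (N n ℤ.+ e n ℤ.* e n ℤ.+ e n ℤ.* pairing n)
        ≡⟨ trans (ι-+ _ _) (cong₂ _+_ (trans (ι-+ _ _) (cong (ι (N n) +_) (ι-* _ _))) (ι-* _ _)) ⟩
      ι (N n) + t * t + t * ι (pairing n) ∎

  1≤VD : ∀ n → 1ℤ ℤ.≤ N n → (∀ κ → 0ℤ ℤ.≤ G n κ) → 1ℚ ≤ ι (V n) * D n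
  1≤VD n 1≤N 0≤G = begin
    1ℚ              ≡⟨ +-identityʳ 1ℚ ⟨
    1ℚ + 0ℚ         ≤⟨ +-mono-≤ (subst (_≤ ι (N n)) ι-1 (ι-mono-≤ 1≤N)) 0≤C ⟩
    ι (N n) + C n   ≡⟨ main-identity n ⟨
    ι (V n) * D n ∎
    where
    open ≤-Reasoning
    0≤C : 0ℚ ≤ C n
    0≤C = ∑-nonneg n λ t _ → nonneg-* (ι-nonneg (0≤G (suc t))) (w-nonneg t)

  VD≤-1 : ∀ n → N n ℤ.≤ ℤ.- 1ℤ → (∀ κ → G n κ ℤ.≤ 0ℤ) → ι (V n) * D n ≤ - 1ℚ
  VD≤-1 n N≤-1 G≤0 = begin
    ι (V n) * D n    ≡⟨ main-identity n ⟩
    ι (N n) + C n    ≤⟨ +-mono-≤ (subst (ι (N n) ≤_) (trans (ι-neg 1ℤ) (cong -_ ι-1)) (ι-mono-≤ N≤-1)) C≤0 ⟩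
    - 1ℚ + 0ℚ        ≡⟨ +-identityʳ (- 1ℚ) ⟩
    - 1ℚ ∎
    where
    open ≤-Reasoning
    C≤0 : C n ≤ 0ℚ
    C≤0 = ∑-nonpos n λ t _ → nonpos-* (subst (ι (G n (suc t)) ≤_) ι-0 (ι-mono-≤ (G≤0 (suc t)))) (w-nonneg t)

module NormSigns where
  open import Data.Integer
  open import Data.Integer.Properties
  open import Data.Integer.Tactic.RingSolver using (solve-∀)
  open import Data.Nat using (z≤n)
  open import Relation.Binary.PropositionalEquality

  open IntegerOrder

  positive-form : ∀ {v t a} → 1ℤ ≤ v → 0ℤ ≤ t → 0ℤ ≤ a → 1ℤ ≤ v * v + t * a * v + a * a
  positive-form {v} {t} {a} 1≤v 0≤t 0≤a =
    ≤-of-gap _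
      (nonneg-+ (nonneg-+ (nonneg-* (i≤j⇒0≤j-i 1≤v) 0≤v+1) (nonneg-* (nonneg-* 0≤t 0≤a) 0≤v)) (nonneg-* 0≤a 0≤a))
      (algebra v t a)
    where
    0≤v : 0ℤ ≤ v
    0≤v = ≤-trans (+≤+ z≤n) 1≤v
    0≤v+1 : 0ℤ ≤ v + 1ℤ
    0≤v+1 = nonneg-+ 0≤v (+≤+ z≤n)
    algebra : ∀ v t a → v * v + t * a * v + a * a ≡ 1ℤ + ((v - 1ℤ) * (v + 1ℤ) + t * a * v + a * a)
    algebra = solve-∀

  negative-form : ∀ {w t a u} → 1ℤ ≤ w → w ≤ u - 1ℤ → 1ℤ ≤ a → a ≤ u - 1ℤ → u + u ≤ t →
    (- w) * (- w) + t * a * (- w) + a * a ≤ - 1ℤ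
  negative-form {w} {t} {a} {u} 1≤w w≤u-1 1≤a a≤u-1 2u≤t =
    ≤-of-gap _ (nonneg-+ (nonneg-+ (nonneg-+ (nonneg-+ (nonneg-+
        (nonneg-* (nonneg-* (i≤j⇒0≤j-i 2u≤t) 0≤a) 0≤w)
        (nonneg-* 0≤w (nonneg-* 0≤u (i≤j⇒0≤j-i 1≤a))))
        (nonneg-* 0≤w (i≤j⇒0≤j-i w≤u-1)))
        (nonneg-* 0≤a (nonneg-* 0≤u (i≤j⇒0≤j-i 1≤w))))
        (nonneg-* 0≤a (i≤j⇒0≤j-i a≤u-1)))
        (nonneg-+ (i≤j⇒0≤j-i 1≤w) 0≤a))
      (algebra w t a u)
    where
    0≤w : 0ℤ ≤ w
    0≤w = ≤-trans (+≤+ z≤n) 1≤w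
    0≤a : 0ℤ ≤ a
    0≤a = ≤-trans (+≤+ z≤n) 1≤a
    0≤u : 0ℤ ≤ u
    0≤u = ≤-trans 0≤w (≤-trans w≤u-1 (i-j≤i u 1ℤ))
    algebra : ∀ w t a u → - 1ℤ ≡ (- w) * (- w) + t * a * (- w) + a * a
      + ((t - (u + u)) * a * w + w * (u * (a - 1ℤ)) + w * (u - 1ℤ - w) + a * (u * (w - 1ℤ)) + a * (u - 1ℤ - a) + (w - 1ℤ + a))
    algebra = solve-∀

  positive-factor : ∀ {x m} → 0ℤ ≤ m → 1ℤ ≤ x * m → 1ℤ ≤ x
  positive-factor {x} {m} 0≤m 1≤xm = i<j⇒suc[i]≤j {0ℤ} (*-cancelʳ-<-nonNeg {0ℤ} {x} m {{nonNegative 0≤m}}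
    (subst (_< x * m) (sym (*-zeroˡ m)) (suc[i]≤j⇒i<j {0ℤ} 1≤xm)))

  negative-factor : ∀ {x m} → 0ℤ ≤ m → x * m ≤ - 1ℤ → x ≤ - 1ℤ
  negative-factor {x} {m} 0≤m xm≤-1 = subst (_≤ - 1ℤ) (neg-involutive x)
    (neg-mono-≤ (positive-factor 0≤m (subst (1ℤ ≤_) (neg-distribˡ-* x m) (neg-mono-≤ xm≤-1))))

module Signs where
  open import Data.Integer using (ℤ; +_; 0ℤ; 1ℤ; _+_; _*_; _-_; -_; _≤_; +≤+)
  open import Data.Integer.Properties
  open import Data.Integer.Tactic.RingSolver using (solve-∀)
  open import Data.Nat as ℕ using (ℕ; suc)
  open import Data.Product using (_×_; _,_)
  open import Data.Rational as ℚ using (1ℚ)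
  import Data.Rational.Properties as ℚ
  open import Function using (_∘_)
  open import Relation.Binary.PropositionalEquality

  open RangeSum +-*-commutativeRing using (∑)
  open EvenFibonacci
  open IntegerOrder
  open DigitStrings
  open IntegerDigitBounds
  open DigitDifferences
  open RationalEmbedding using (ι; ι-neg)
  open NormSigns

  U-suc-dominated : PrefixDominated (λ j → U (suc j))
  U-suc-dominated d valid p = ≤-trans (value-bound valid p) (i-j≤i (U (suc p)) 1ℤ)

  module Cases {ca cb : ℕ → ℕ} (valid-a : Valid ca) (valid-b : Valid cb) (n : ℕ)
               (lead : BottomLead cb ca) (lead<n : BottomLead.position lead ℕ.< n) where

    open WeightedSums (diff cb ca)
    open KeyIdentity (diff cb ca)

    lower-U-nonneg : ∀ κ → 0ℤ ≤ lower (λ k → U (suc k)) κ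
    lower-U-nonneg = bottom-sum-nonneg valid-a (λ k → U (suc k)) (λ k → U (suc k) - 1ℤ) (λ k → U-nonneg (suc k))
                       (λ _ → suffix-value-bound) (λ k → i-j≤i (U (suc k)) 1ℤ) lead

    lower-Δ-nonneg : ∀ κ → 0ℤ ≤ lower Δ κ
    lower-Δ-nonneg = bottom-sum-nonneg valid-a Δ Δ Δ-nonneg (λ _ → suffix-Δ-bound) (λ _ → ≤-refl) lead

    A-pos : 1ℤ ≤ A n
    A-pos = bottom-sum valid-a (λ k → U (suc k)) (λ k → U (suc k) - 1ℤ) (λ k → U-nonneg (suc k))
              (λ _ → suffix-value-bound) (λ k → ≤-reflexive (algebra (U (suc k)))) lead n lead<n
      where
      algebra : ∀ x → 1ℤ + (x - 1ℤ) ≡ x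
      algebra = solve-∀

    A-bound : A n ≤ U (suc n) - 1ℤ
    A-bound = ≤-trans (diff-sum-≤ n cb ca (λ j → U (suc (n ℕ.∸ suc j))) (λ j → U-nonneg (suc (n ℕ.∸ suc j))))
                (subst (_≤ U (suc n) - 1ℤ) (suffix-sum≡∑ cb (λ _ k → U (suc k)) n 0) (suffix-value-bound valid-b n 0))

    private
      T≥2u : U (suc n) + U (suc n) ≤ + 3 * U (suc n) - + 2 * U n
      T≥2u = ≤-of-gap _ (i≤j⇒0≤j-i (U-double n)) (algebra (U (suc n)) (U n))
        where
        algebra : ∀ u u′ → + 3 * u - + 2 * u′ ≡ u + u + (u - (u′ + u′))
        algebra = solve-∀

      0≤u² : 0ℤ ≤ U (suc n) * U (suc n)
      0≤u² = nonneg-* (U-nonneg (suc n)) (U-nonneg (suc n))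

    case-b>a : LexGE n cb ca → V n ≢ 0ℤ → 1ℤ ≤ V n × 1ℚ ℚ.≤ ι (V n) ℚ.* D n
    case-b>a ge V≢0 = 1≤V , 1≤VD n 1≤N 0≤G
      where
      0≤V : 0ℤ ≤ V n
      0≤V = lex-sum-nonneg valid-a ge (λ j → U (suc j)) (λ j → U-nonneg (suc j)) U-suc-dominated
      1≤V : 1ℤ ≤ V n
      1≤V = i<j⇒suc[i]≤j (≤∧≢⇒< 0≤V (V≢0 ∘ sym))
      0≤G : ∀ κ → 0ℤ ≤ G n κ
      0≤G κ = subst (0ℤ ≤_) (sym (G-split n κ)) (nonneg-+
        (nonneg-* (lex-sum-nonneg-shifted valid-a ge Δ Δ-nonneg (λ _ → Δ-weighted-bound) κ) (lower-U-nonneg κ))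
        (nonneg-* (lex-sum-nonneg-shifted valid-a ge U U-nonneg (λ _ → shifted-value-bound) κ) (lower-Δ-nonneg κ)))
      1≤N : 1ℤ ≤ N n
      1≤N = positive-factor 0≤u² (subst (1ℤ ≤_) (sym (norm-identity n))
              (positive-form 1≤V (≤-trans (nonneg-+ (U-nonneg (suc n)) (U-nonneg (suc n))) T≥2u)
                                 (≤-trans (+≤+ ℕ.z≤n) A-pos)))

    case-a>b : LexGE n ca cb → V n ≢ 0ℤ → 1ℤ ≤ - V n × 1ℚ ℚ.≤ ι (- V n) ℚ.* D n
    case-a>b le V≢0 = 1≤W , subst (1ℚ ℚ.≤_) (sym ι[-V]D) (ℚ.neg-antimono-≤ (VD≤-1 n N≤-1 G≤0))
      where
      W : ℤ
      W = ∑[ j < n ] (diff ca cb j * U (suc j))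
      V≡-W : V n ≡ - W
      V≡-W = diff-sum-swap n ca cb (λ j → j) (λ j → U (suc j))
      -V≡W : - V n ≡ W
      -V≡W = trans (cong -_ V≡-W) (neg-involutive W)
      0≤W : 0ℤ ≤ W
      0≤W = lex-sum-nonneg valid-b le (λ j → U (suc j)) (λ j → U-nonneg (suc j)) U-suc-dominated
      1≤W : 1ℤ ≤ - V n
      1≤W = subst (1ℤ ≤_) (sym -V≡W) (i<j⇒suc[i]≤j (≤∧≢⇒< 0≤W λ 0≡W → V≢0 (trans V≡-W (cong -_ (sym 0≡W)))))
      W≤u-1 : - V n ≤ U (suc n) - 1ℤ
      W≤u-1 = subst (_≤ U (suc n) - 1ℤ) (sym -V≡W)
                (≤-trans (diff-sum-≤ n ca cb (λ j → U (suc j)) (λ j → U-nonneg (suc j))) (value-bound valid-a n))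
      upper≤0 : ∀ ω → (∀ j → 0ℤ ≤ ω j) → PrefixDominated ω → ∀ κ → upper ω n κ ≤ 0ℤ
      upper≤0 ω 0≤ω dominated κ = subst (_≤ 0ℤ) (sym (diff-sum-swap (n ℕ.∸ κ) ca cb (κ ℕ.+_) ω))
                                    (neg-mono-≤ (lex-sum-nonneg-shifted valid-b le ω 0≤ω dominated κ))
      G≤0 : ∀ κ → G n κ ≤ 0ℤ
      G≤0 κ = subst (_≤ 0ℤ) (sym (G-split n κ)) (+-mono-≤
        (nonpos-* (upper≤0 Δ Δ-nonneg (λ _ → Δ-weighted-bound) κ) (lower-U-nonneg κ))
        (nonpos-* (upper≤0 U U-nonneg (λ _ → shifted-value-bound) κ) (lower-Δ-nonneg κ)))
      N≤-1 : N n ≤ - 1ℤ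
      N≤-1 = negative-factor 0≤u²
        (subst (_≤ - 1ℤ) (sym (trans (norm-identity n) (cong (λ v → v * v + T * A n * v + A n * A n) V≡--V)))
               (negative-form {u = U (suc n)} 1≤W W≤u-1 A-pos A-bound T≥2u))
        where
        T : ℤ
        T = + 3 * U (suc n) - + 2 * U n
        V≡--V : V n ≡ - (- V n)
        V≡--V = sym (neg-involutive (V n))
      ι[-V]D : ι (- V n) ℚ.* D n ≡ ℚ.- (ι (V n) ℚ.* D n)
      ι[-V]D = trans (cong (ℚ._* D n) (ι-neg (V n))) (sym (ℚ.neg-distribˡ-* (ι (V n)) (D n)))

module Representations where
  open import Data.Integer as ℤ using (ℤ; +_)
  import Data.Integer.Properties as ℤ
  open import Data.List using ([]; _∷_; length)
  open import Data.List.Relation.Unary.All using (All; []; _∷_)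
  open import Data.Nat as ℕ using (ℕ; zero; suc; _≤_; z≤n; s≤s)
  import Data.Nat.Properties as ℕ
  open import Data.Product using (_,_; proj₁; proj₂)
  open import Data.Rational using (ℚ; 1ℚ; _+_; _-_; _*_; _/_)
  import Data.Rational.Properties as ℚ
  open import Relation.Binary.PropositionalEquality
  open import Tactic.RingSolver using (solve-∀)
  open ≡-Reasoning

  open import Defs
  open EvenFibonacci
  open DigitStrings
  open RationalEmbedding
  open Reciprocals
  open DigitDifferences using (diff; diff-def; diff-*-distrib)

  private module ℤ∑ = RangeSum ℤ.+-*-commutativeRing

  digit-beyond : ∀ ds i → length ds ≤ i → digit ds i ≡ 0
  digit-beyond []       i       _         = refl
  digit-beyond (d ∷ ds) (suc i) (s≤s len≤i) = digit-beyond ds i len≤i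

  IsRep⇒Valid : ∀ {ds N} → IsRep ds N → Valid (digit ds)
  IsRep⇒Valid {ds} (all≤2 , _ , separated) = digit-≤2 ds all≤2 , separated
    where
    digit-≤2 : ∀ ds → All (_≤ 2) ds → ∀ i → digit ds i ≤ 2
    digit-≤2 []       _           i       = z≤n
    digit-≤2 (d ∷ ds) (d≤2 ∷ _)   zero    = d≤2
    digit-≤2 (d ∷ ds) (_ ∷ all≤2) (suc i) = digit-≤2 ds all≤2 i

  valueFrom-∑ : ∀ ds k → + valueFrom k ds ≡ ℤ∑.∑ (length ds) (λ i → + digit ds i ℤ.* U (suc (k ℕ.+ i)))
  valueFrom-∑ []       k = refl
  valueFrom-∑ (d ∷ ds) k = begin
    + (d ℕ.* u (suc k) ℕ.+ valueFrom (suc k) ds)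
      ≡⟨ trans (ℤ.pos-+ (d ℕ.* u (suc k)) _) (cong₂ ℤ._+_ (ℤ.pos-* d (u (suc k))) (valueFrom-∑ ds (suc k))) ⟩
    + d ℤ.* U (suc k) ℤ.+ ℤ∑.∑ (length ds) (λ i → + digit ds i ℤ.* U (suc (suc k ℕ.+ i)))
      ≡⟨ cong₂ ℤ._+_ (cong (λ m → + d ℤ.* U (suc m)) (sym (ℕ.+-identityʳ k)))
                     (ℤ∑.∑-cong (length ds) λ i _ → cong (λ m → + digit ds i ℤ.* U (suc m)) (sym (ℕ.+-suc k i))) ⟩
    f 0 ℤ.+ ℤ∑.∑ (length ds) (λ i → f (suc i))
      ≡⟨ ℤ∑.∑-front (length ds) f ⟨
    ℤ∑.∑ (suc (length ds)) f ∎
    where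
    f : ℕ → ℤ
    f i = + digit (d ∷ ds) i ℤ.* U (suc (k ℕ.+ i))

  value-∑ : ∀ ds p → + value ds ≡ ℤ∑.∑ (length ds ℕ.+ p) (λ i → + digit ds i ℤ.* U (suc i))
  value-∑ ds p = trans (valueFrom-∑ ds 0) (sym (ℤ∑.∑-zero-tail (length ds) p _ λ i _ →
    cong (λ d → + d ℤ.* U (suc (length ds ℕ.+ i))) (digit-beyond ds (length ds ℕ.+ i) (ℕ.m≤m+n (length ds) i))))

  frac≡ι*r : ∀ d k → ((+ d) / u (suc k)) {{u-suc-nonZero k}} ≡ ι (+ d) * r k
  frac≡ι*r d k = begin
    q                           ≡⟨ ℚ.*-identityʳ q ⟨
    q * 1ℚ                      ≡⟨ cong (q *_) (u*r≡1 k) ⟨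
    q * (ι (U (suc k)) * r k)   ≡⟨ ℚ.*-assoc q (ι (U (suc k))) (r k) ⟨
    q * ι (U (suc k)) * r k     ≡⟨ cong (_* r k) (frac-*-ι (+ d) (u (suc k)) {{u-suc-nonZero k}}) ⟩
    ι (+ d) * r k ∎
    where
    q : ℚ
    q = ((+ d) / u (suc k)) {{u-suc-nonZero k}}

  recipFrom-∑ : ∀ ds k → recipFrom k ds ≡ ∑[ i < length ds ] (ι (+ digit ds i) * r (k ℕ.+ i))
  recipFrom-∑ []       k = refl
  recipFrom-∑ (d ∷ ds) k = begin
    ((+ d) / u (suc k)) {{u-suc-nonZero k}} + recipFrom (suc k) ds
      ≡⟨ cong₂ _+_ (trans (frac≡ι*r d k) (cong (λ m → ι (+ d) * r m) (sym (ℕ.+-identityʳ k)))) (recipFrom-∑ ds (suc k)) ⟩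
    f 0 + ∑[ i < length ds ] (ι (+ digit ds i) * r (suc k ℕ.+ i))
      ≡⟨ cong (λ s → f 0 + s) (∑-cong (length ds) λ i _ → cong (λ m → ι (+ digit ds i) * r m) (sym (ℕ.+-suc k i))) ⟩
    f 0 + ∑[ i < length ds ] f (suc i)
      ≡⟨ ∑-front (length ds) f ⟨
    ∑ (suc (length ds)) f ∎
    where
    f : ℕ → ℚ
    f i = ι (+ digit (d ∷ ds) i) * r (k ℕ.+ i)

  fRep-∑ : ∀ ds p → fRep ds ≡ ∑[ i < length ds ℕ.+ p ] (ι (+ digit ds i) * r i)
  fRep-∑ ds p = trans (recipFrom-∑ ds 0) (sym (∑-zero-tail (length ds) p _ λ i _ →
    trans (cong (λ d → ι (+ d) * r (length ds ℕ.+ i)) (digit-beyond ds (length ds ℕ.+ i) (ℕ.m≤m+n (length ds) i)))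
          (trans (cong (_* r (length ds ℕ.+ i)) ι-0) (ℚ.*-zeroˡ (r (length ds ℕ.+ i))))))

  value-difference : ∀ {a b da db} → IsRep da a → IsRep db b →
    ℤ∑.∑ (length da ℕ.+ length db) (λ j → diff (digit db) (digit da) j ℤ.* U (suc j)) ≡ + b ℤ.- + a
  value-difference {a} {b} {da} {db} rep-a rep-b = begin
    ℤ∑.∑ n (λ j → diff cb ca j ℤ.* U (suc j))
      ≡⟨ ℤ∑.∑-cong n (λ j _ → diff-*-distrib cb ca j (U (suc j))) ⟩
    ℤ∑.∑ n (λ j → + cb j ℤ.* U (suc j) ℤ.- + ca j ℤ.* U (suc j))
      ≡⟨ ℤ∑.∑-distrib-sub n _ _ ⟩
    ℤ∑.∑ n (λ j → + cb j ℤ.* U (suc j)) ℤ.- ℤ∑.∑ n (λ j → + ca j ℤ.* U (suc j))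
      ≡⟨ cong₂ ℤ._-_ (trans (cong (λ m → ℤ∑.∑ m (λ j → + cb j ℤ.* U (suc j))) (ℕ.+-comm (length da) (length db)))
                            (sym (value-∑ db (length da))))
                     (sym (value-∑ da (length db))) ⟩
    + value db ℤ.- + value da
      ≡⟨ cong₂ (λ x y → + x ℤ.- + y) (proj₁ (proj₂ rep-b)) (proj₁ (proj₂ rep-a)) ⟩
    + b ℤ.- + a ∎
    where
    ca cb : ℕ → ℕ
    ca = digit da
    cb = digit db
    n : ℕ
    n = length da ℕ.+ length db

  fRep-difference : ∀ da db → ∑[ j < length da ℕ.+ length db ] (ι (diff (digit db) (digit da) j) * r j) ≡ fRep db - fRep da
  fRep-difference da db = begin
    ∑[ j < n ] (ι (diff cb ca j) * r j)                           ≡⟨ ∑-cong n (λ j _ → distrib j) ⟩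
    ∑[ j < n ] (ι (+ cb j) * r j - ι (+ ca j) * r j)              ≡⟨ ∑-distrib-sub n _ _ ⟩
    ∑[ j < n ] (ι (+ cb j) * r j) - ∑[ j < n ] (ι (+ ca j) * r j)
      ≡⟨ cong₂ _-_ (trans (cong (λ m → ∑ m (λ j → ι (+ cb j) * r j)) (ℕ.+-comm (length da) (length db)))
                          (sym (fRep-∑ db (length da))))
                   (sym (fRep-∑ da (length db))) ⟩
    fRep db - fRep da ∎
    where
    ca cb : ℕ → ℕ
    ca = digit da
    cb = digit db
    n : ℕ
    n = length da ℕ.+ length db
    algebra : ∀ x y ρ → (x - y) * ρ ≡ x * ρ - y * ρ
    algebra = solve-∀ ℚ-ring
    distrib : ∀ j → ι (diff cb ca j) * r j ≡ ι (+ cb j) * r j - ι (+ ca j) * r j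
    distrib j = trans (cong (λ z → ι z * r j) (diff-def cb ca j))
                      (trans (cong (_* r j) (ι-- (+ cb j) (+ ca j))) (algebra (ι (+ cb j)) (ι (+ ca j)) (r j)))

open import Data.Empty using (⊥-elim)
open import Data.Integer as ℤ using (+_; 0ℤ; 1ℤ)
import Data.Integer.Properties as ℤ
open import Data.List using (List; length)
open import Data.Nat as ℕ using (ℕ; suc; ∣_-_∣)
import Data.Nat.Properties as ℕ
open import Data.Product using (Σ; _,_)
open import Data.Rational using (0ℚ; 1ℚ; _*_; _-_; _≤_; _<_; _/_; positive)
import Data.Rational.Properties as ℚ
open import Data.Sum using (inj₁; inj₂)
open import Function using (_∘_)
open import Relation.Binary.PropositionalEquality

open import Defs
open EvenFibonacci using (U)
open DigitStrings using (Valid)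
open DigitDifferences using (diff; diff-agree; lex-total; BottomLead; first-difference)
open RationalEmbedding using (ι; ι-0; ι-1; ι-mono-<; frac-*-ι; p<q⇒0<q-p)
open ReciprocalTail using (reciprocal-sum-neg)
open Signs using (module Cases)
open Representations using (IsRep⇒Valid; value-difference; fRep-difference)

private module ℤ∑ = RangeSum ℤ.+-*-commutativeRing

abs-difference : ∀ a b → ℤ.∣ + b ℤ.- + a ∣ ≡ ∣ b - a ∣
abs-difference a b with ℕ.≤-total a b
... | inj₁ a≤b = begin
  ℤ.∣ + b ℤ.- + a ∣   ≡⟨ cong ℤ.∣_∣ (trans (ℤ.m-n≡m⊖n b a) (ℤ.⊖-≥ a≤b)) ⟩
  b ℕ.∸ a             ≡⟨ ℕ.m≤n⇒∣n-m∣≡n∸m a≤b ⟨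
  ∣ b - a ∣ ∎
  where open ≡-Reasoning
... | inj₂ b≤a = begin
  ℤ.∣ + b ℤ.- + a ∣   ≡⟨ cong ℤ.∣_∣ (ℤ.m-n≡m⊖n b a) ⟩
  ℤ.∣ b ℤ.⊖ a ∣       ≡⟨ ℤ.∣⊖∣-≤ b≤a ⟩
  a ℕ.∸ b             ≡⟨ ℕ.m≤n⇒∣m-n∣≡n∸m b≤a ⟨
  ∣ b - a ∣ ∎
  where open ≡-Reasoning

reciprocal-bound : ∀ m .{{_ : ℕ.NonZero m}} {x} → 1ℚ ≤ ι (+ m) * x → (+ 1 / m) ≤ x
reciprocal-bound m {x} 1≤mx = ℚ.*-cancelʳ-≤-pos (ι (+ m)) {{positive 0<m}}
  (subst₂ _≤_ (sym (trans (frac-*-ι (+ 1) m) ι-1)) (ℚ.*-comm (ι (+ m)) x) 1≤mx)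
  where
  0<m : 0ℚ < ι (+ m)
  0<m = subst (_< ι (+ m)) ι-0 (ι-mono-< (ℤ.+<+ (ℕ.>-nonZero⁻¹ m)))

module Conclusion {a b da db} (rep-a : IsRep da a) (rep-b : IsRep db b) (a≢b : a ≢ b) where
  private
    ca cb : ℕ → ℕ
    ca = digit da
    cb = digit db
    n : ℕ
    n = length da ℕ.+ length db
    valid-a : Valid ca
    valid-a = IsRep⇒Valid rep-a
    valid-b : Valid cb
    valid-b = IsRep⇒Valid rep-b

  open WeightedSums (diff cb ca) using (V)
  open KeyIdentity (diff cb ca) using (D)

  V≢0 : V n ≢ 0ℤ
  V≢0 V≡0 = a≢b (sym (ℤ.+-injective (ℤ.i-j≡0⇒i≡j (+ b) (+ a) (trans (sym (value-difference rep-a rep-b)) V≡0))))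

  lead-of-b : 0ℚ < D n → Σ (BottomLead cb ca) (λ lead → BottomLead.position lead ℕ.< n)
  lead-of-b 0<D with first-difference n cb ca
  ... | inj₁ agree = ⊥-elim (V≢0 (ℤ∑.∑-zero n λ j j<n →
    trans (cong (ℤ._* U (suc j)) (diff-agree (agree j j<n))) (ℤ.*-zeroˡ (U (suc j)))))
  ... | inj₂ (inj₁ lead) = lead
  ... | inj₂ (inj₂ (lead-a , m<n)) = ⊥-elim (ℚ.<-asym 0<D (reciprocal-sum-neg valid-b lead-a n m<n))

  private
    bound-via : ∀ {W} → 1ℤ ℤ.≤ W → ℤ.∣ W ∣ ≡ ∣ b - a ∣ → 1ℚ ≤ ι W * D n →
      (+ 1 / ∣ b - a ∣) {{dist-nonZero (a≢b ∘ sym)}} ≤ D n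
    bound-via {W} 1≤W ∣W∣≡∣b-a∣ 1≤WD = reciprocal-bound ∣ b - a ∣ {{dist-nonZero (a≢b ∘ sym)}}
      (subst (λ z → 1ℚ ≤ ι z * D n) (trans (sym (ℤ.0≤i⇒+∣i∣≡i (ℤ.≤-trans (ℤ.+≤+ ℕ.z≤n) 1≤W))) (cong +_ ∣W∣≡∣b-a∣))
             1≤WD)

    ∣V∣≡∣b-a∣ : ℤ.∣ V n ∣ ≡ ∣ b - a ∣
    ∣V∣≡∣b-a∣ = trans (cong ℤ.∣_∣ (value-difference rep-a rep-b)) (abs-difference a b)

  distance-bound : 0ℚ < D n → (+ 1 / ∣ b - a ∣) {{dist-nonZero (a≢b ∘ sym)}} ≤ D n
  distance-bound 0<D with lead-of-b 0<D
  ... | lead , lead<n with lex-total n cb ca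
  ...   | inj₁ b≥a = let 1≤V , 1≤VD = case-b>a b≥a V≢0 in bound-via 1≤V ∣V∣≡∣b-a∣ 1≤VD
    where open Cases valid-a valid-b n lead lead<n
  ...   | inj₂ a≥b = let 1≤-V , 1≤-VD = case-a>b a≥b V≢0 in
                     bound-via 1≤-V (trans (ℤ.∣-i∣≡∣i∣ (V n)) ∣V∣≡∣b-a∣) 1≤-VD
    where open Cases valid-a valid-b n lead lead<n

theorem15 : (a b : ℕ) (da db : List ℕ) → IsRep da a → IsRep db b →
    (a≢b : a ≢ b) → fRep da < fRep db →
    _/_ (+ 1) ∣ b - a ∣ {{dist-nonZero (λ eq → a≢b (sym eq))}} ≤ fRep db - fRep da
theorem15 a b da db rep-a rep-b a≢b fa<fb =
  subst (_ ≤_) (fRep-difference da db) (distance-bound (subst (0ℚ <_) (sym (fRep-difference da db)) (p<q⇒0<q-p fa<fb)))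
  where open Conclusion rep-a rep-b a≢b
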